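{- Let $m>2$ and $k$ be integers with $0<k<2^m$, and let $N=k\cdot 2^m+1$. Suppose that one of the following holds: $k \equiv 1 \pmod{42}$ and $m \equiv 2,4 \pmod{6}$; $k \equiv 5 \pmod{42}$ and $m \equiv 3 \pmod{6}$; $k \equiv 11 \pmod{42}$ and $m \equiv 3,5 \pmod{6}$; $k \equiv 13 \pmod{42}$ and $m \equiv 4 \pmod{6}$; $k \equiv 17 \pmod{42}$ and $m \equiv 5 \pmod{6}$; $k \equiv 19 \pmod{42}$ and $m \equiv 0 \pmod{6}$; $k \equiv 23 \pmod{42}$ and $m \equiv 1,3 \pmod{6}$; $k \equiv 25 \pmod{42}$ and $m \equiv 0,2 \pmod{6}$; $k \equiv 29 \pmod{42}$ and $m \equiv 1,5 \pmod{6}$; $k \equiv 31 \pmod{42}$ and $m \equiv 2 \pmod{6}$; $k \equiv 37 \pmod{42}$ and $m \equiv 0,4 \pmod{6}$; $k \equiv 41 \pmod{42}$ and $m \equiv 1 \pmod{6}$. Let $x=V_k(5,1)$. Then $N$ is prime if and only if $N \mid S_{m-2}(x)$.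
   Context: For $P,Q\in\mathbb{Z}$ the Lucas sequence $\{V_n(P,Q)\}$ is defined by $V_0(P,Q)=2$, $V_1(P,Q)=P$, $V_{n+1}(P,Q)=PV_n(P,Q)-QV_{n-1}(P,Q)$ for $n\ge 1$. For an integer $x$, the sequence $S_n(x)$ is defined by $S_0(x)=x$ and $S_{j+1}(x)=(S_j(x))^2-2$ for $j\ge 0$. -}

module Defs where

open import Data.Nat as ℕ using (ℕ; zero; suc; _%_)
open import Data.Integer as ℤ using (ℤ; +_; _-_; _*_)
open import Data.Product using (_×_)
open import Data.Sum using (_⊎_)
open import Relation.Binary.PropositionalEquality using (_≡_)

V : ℤ → ℤ → ℕ → ℤ
V P Q zero = + 2
V P Q (suc zero) = P
V P Q (suc (suc n)) = P * V P Q (suc n) - Q * V P Q n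

S : ℕ → ℤ → ℤ
S zero x = x
S (suc j) x = S j x * S j x - + 2

CongCond : ℕ → ℕ → Set
CongCond k m =
    (k % 42 ≡ 1  × (m % 6 ≡ 2 ⊎ m % 6 ≡ 4))
  ⊎ (k % 42 ≡ 5  × m % 6 ≡ 3)
  ⊎ (k % 42 ≡ 11 × (m % 6 ≡ 3 ⊎ m % 6 ≡ 5))
  ⊎ (k % 42 ≡ 13 × m % 6 ≡ 4)
  ⊎ (k % 42 ≡ 17 × m % 6 ≡ 5)
  ⊎ (k % 42 ≡ 19 × m % 6 ≡ 0)
  ⊎ (k % 42 ≡ 23 × (m % 6 ≡ 1 ⊎ m % 6 ≡ 3))
  ⊎ (k % 42 ≡ 25 × (m % 6 ≡ 0 ⊎ m % 6 ≡ 2))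
  ⊎ (k % 42 ≡ 29 × (m % 6 ≡ 1 ⊎ m % 6 ≡ 5))
  ⊎ (k % 42 ≡ 31 × m % 6 ≡ 2)
  ⊎ (k % 42 ≡ 37 × (m % 6 ≡ 0 ⊎ m % 6 ≡ 4))
  ⊎ (k % 42 ≡ 41 × m % 6 ≡ 1)

module Submission where

-- Work in (ℤ/p)[α], α² = 5α - 1, where β = 5 - α = α⁻¹, V_k = α^k + β^k and
-- S_j(V_k) = α^t + β^t (t = k 2^j), which vanishes iff α^(2t) = -1.  The congruence
-- conditions say N ≡ 2 (mod 3) and N ≡ 3, 5, 6 (mod 7).
-- Necessity: Euler's criterion, via the Frobenius map on (ℤ/N)[ω] and on (ℤ/N)[ζ₇]
-- (a Gauss sum), shows (-3)^((N-1)/2) ≡ (-7)^((N-1)/2) ≡ -1; so 21 is a residue,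
-- α^N = α, and δ = α - 1 with δ² = 3α yields α^((N-1)/2) = -1.
-- Sufficiency: for a prime p | N, α^(k 2^(m-1)) = -1 while α^(p∓1) = 1, so 2^m ≤ p + 1;
-- p = 2^m - 1 is impossible as k is odd, so all prime factors exceed √N.

open import Level using (0ℓ)
open import Algebra.Bundles using (CommutativeRing)
open import Data.Nat using (ℕ)
open import Data.Integer using (ℤ)

module Congruence where

  open import Data.Nat as ℕ using (ℕ)
  open import Data.Nat.Divisibility as ℕD using (divides)
  open import Data.Integer as ℤ using (ℤ; +_; -[1+_]; _+_; _-_; _*_; -_)
  open import Data.Integer.Properties using (pos-+; pos-*; abs-*; *-identityˡ)
  import Data.Integer.Divisibility as ℤD
  open import Data.Integer.Tactic.RingSolver using (solve-∀)
  open import Data.Nat.Primality using (Prime; euclidsLemma)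
  open import Data.Sum using (_⊎_; inj₁; inj₂)
  open import Data.Empty using (⊥-elim)
  open import Relation.Nullary using (¬_)
  open import Relation.Binary.PropositionalEquality

  infix 4 _≡[_]_
  record _≡[_]_ (x : ℤ) (n : ℕ) (y : ℤ) : Set where
    constructor mod
    field
      quo : ℤ
      quo-eq : x - y ≡ quo * + n

  private
    sub-self : ∀ x n → x - x ≡ + 0 * n
    sub-self = solve-∀
    sub-swap : ∀ x y → y - x ≡ - (x - y)
    sub-swap = solve-∀
    sub-split : ∀ x y z → x - z ≡ (x - y) + (y - z)
    sub-split = solve-∀
    sub-+ : ∀ x y x' y' → (x + y) - (x' + y') ≡ (x - x') + (y - y')
    sub-+ = solve-∀
    sub-* : ∀ x y x' y' → x * y - x' * y' ≡ (x - x') * y + x' * (y - y')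
    sub-* = solve-∀
    sub-neg : ∀ x x' → (- x) - (- x') ≡ - (x - x')
    sub-neg = solve-∀
    sub-zero : ∀ x → x - + 0 ≡ x
    sub-zero = solve-∀
    factor-+ : ∀ q r n → q * n + r * n ≡ (q + r) * n
    factor-+ = solve-∀
    factor-* : ∀ q r y x' n → (q * n) * y + x' * (r * n) ≡ (q * y + x' * r) * n
    factor-* = solve-∀
    factor-neg : ∀ q n → - (q * n) ≡ (- q) * n
    factor-neg = solve-∀
    reassoc : ∀ q c d → q * (c * d) ≡ (q * c) * d
    reassoc = solve-∀
    cancel-+ : ∀ q n b → (q * n + b) - b ≡ q * n
    cancel-+ = solve-∀
    difference-of-squares : ∀ a c → a * (c * c) - a ≡ a * ((c - + 1) * (c + + 1))
    difference-of-squares = solve-∀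
    add-one : ∀ c → c + + 1 ≡ c - -[1+ 0 ]
    add-one = solve-∀

  module _ {n : ℕ} where

    ≡ₙ-refl : ∀ {x} → x ≡[ n ] x
    ≡ₙ-refl {x} = mod (+ 0) (sub-self x (+ n))

    ≡ₙ-reflexive : ∀ {x y} → x ≡ y → x ≡[ n ] y
    ≡ₙ-reflexive refl = ≡ₙ-refl

    ≡ₙ-sym : ∀ {x y} → x ≡[ n ] y → y ≡[ n ] x
    ≡ₙ-sym {x} {y} (mod q e) =
      mod (- q) (trans (sub-swap x y) (trans (cong -_ e) (factor-neg q (+ n))))

    ≡ₙ-trans : ∀ {x y z} → x ≡[ n ] y → y ≡[ n ] z → x ≡[ n ] z
    ≡ₙ-trans {x} {y} {z} (mod q e) (mod r f) =
      mod (q + r) (trans (sub-split x y z) (trans (cong₂ _+_ e f) (factor-+ q r (+ n))))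

    ≡ₙ-+ : ∀ {x y x' y'} → x ≡[ n ] x' → y ≡[ n ] y' → x + y ≡[ n ] x' + y'
    ≡ₙ-+ {x} {y} {x'} {y'} (mod q e) (mod r f) =
      mod (q + r) (trans (sub-+ x y x' y') (trans (cong₂ _+_ e f) (factor-+ q r (+ n))))

    ≡ₙ-* : ∀ {x y x' y'} → x ≡[ n ] x' → y ≡[ n ] y' → x * y ≡[ n ] x' * y'
    ≡ₙ-* {x} {y} {x'} {y'} (mod q e) (mod r f) =
      mod (q * y + x' * r)
        (trans (sub-* x y x' y') (trans (cong₂ (λ a b → a * y + x' * b) e f) (factor-* q r y x' (+ n))))

    ≡ₙ-neg : ∀ {x x'} → x ≡[ n ] x' → - x ≡[ n ] - x'
    ≡ₙ-neg {x} {x'} (mod q e) =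
      mod (- q) (trans (sub-neg x x') (trans (cong -_ e) (factor-neg q (+ n))))

    ≡ₙ-modulus : + n ≡[ n ] + 0
    ≡ₙ-modulus = mod (+ 1) (trans (sub-zero (+ n)) (sym (*-identityˡ (+ n))))

    ≡ₙ-sub : ∀ {x y} → x ≡[ n ] y → x - y ≡[ n ] + 0
    ≡ₙ-sub {x} {y} (mod q e) = mod q (trans (sub-zero (x - y)) e)

    ≡ₙ-unsub : ∀ {x y} → x - y ≡[ n ] + 0 → x ≡[ n ] y
    ≡ₙ-unsub {x} {y} (mod q e) = mod q (trans (sym (sub-zero (x - y))) e)

  ≡ₙ-from-divmod : ∀ {n} a b c → a ≡ c ℕ.* n ℕ.+ b → + a ≡[ n ] + b
  ≡ₙ-from-divmod {n} a b c refl =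
    mod (+ c) (trans (cong (_- + b) (trans (pos-+ (c ℕ.* n) b) (cong (_+ + b) (pos-* c n))))
                     (cancel-+ (+ c) (+ n) (+ b)))

  ≡ₙ0⇒∣ : ∀ {n x} → x ≡[ n ] + 0 → (+ n) ℤD.∣ x
  ≡ₙ0⇒∣ {n} {x} (mod q e) = divides ℤ.∣ q ∣ (trans (cong ℤ.∣_∣ (trans (sym (sub-zero x)) e)) (abs-* q (+ n)))

  ∣⇒≡ₙ0 : ∀ {n x} → (+ n) ℤD.∣ x → x ≡[ n ] + 0
  ∣⇒≡ₙ0 {n} {+ m} (divides c e) = mod (+ c) (trans (sub-zero (+ m)) (trans (cong +_ e) (pos-* c n)))
  ∣⇒≡ₙ0 {n} { -[1+ m ]} (divides c e) =
    mod (- (+ c)) (trans (cong (λ z → - z - + 0) (trans (cong +_ e) (pos-* c n))) (lemma (+ c) (+ n)))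
    where
      lemma : ∀ c n → - (c * n) - + 0 ≡ (- c) * n
      lemma = solve-∀

  ≡ₙ-divisor : ∀ {d n x y} → d ℕD.∣ n → x ≡[ n ] y → x ≡[ d ] y
  ≡ₙ-divisor {d} (divides c refl) (mod q e) =
    mod (q * + c) (trans e (trans (cong (q *_) (pos-* c d)) (reassoc q (+ c) (+ d))))

  -- Modulo a prime p, the only square roots of 1 are ±1; stated with a factor a ≢ 0
  -- (a c² ≡ a) as it arises from Fermat's theorem a^p ≡ a.
  square-root-of-one : ∀ {p} → Prime p → (a c : ℤ) → ¬ (p ℕD.∣ ℤ.∣ a ∣) → a * (c * c) ≡[ p ] a →
                       (c ≡[ p ] + 1) ⊎ (c ≡[ p ] -[1+ 0 ])
  square-root-of-one {p} p-prime a c p∤a acc≡a = from-factors (euclidsLemma ℤ.∣ a ∣ _ p-prime p∣a[c-1][c+1])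
    where
      p∣a[c-1][c+1] : p ℕD.∣ ℤ.∣ a ∣ ℕ.* ℤ.∣ (c - + 1) * (c + + 1) ∣
      p∣a[c-1][c+1] = subst (p ℕD.∣_) (abs-* a ((c - + 1) * (c + + 1)))
                        (≡ₙ0⇒∣ (≡ₙ-trans (≡ₙ-reflexive (sym (difference-of-squares a c))) (≡ₙ-sub acc≡a)))
      from-root : (p ℕD.∣ ℤ.∣ c - + 1 ∣) ⊎ (p ℕD.∣ ℤ.∣ c + + 1 ∣) → (c ≡[ p ] + 1) ⊎ (c ≡[ p ] -[1+ 0 ])
      from-root (inj₁ p∣c-1) = inj₁ (≡ₙ-unsub (∣⇒≡ₙ0 p∣c-1))
      from-root (inj₂ p∣c+1) = inj₂ (≡ₙ-unsub (subst (_≡[ p ] + 0) (add-one c) (∣⇒≡ₙ0 p∣c+1)))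
      from-factors : (p ℕD.∣ ℤ.∣ a ∣) ⊎ (p ℕD.∣ ℤ.∣ (c - + 1) * (c + + 1) ∣) → (c ≡[ p ] + 1) ⊎ (c ≡[ p ] -[1+ 0 ])
      from-factors (inj₁ p∣a) = ⊥-elim (p∤a p∣a)
      from-factors (inj₂ p∣c²-1) =
        from-root (euclidsLemma ℤ.∣ c - + 1 ∣ ℤ.∣ c + + 1 ∣ p-prime (subst (p ℕD.∣_) (abs-* (c - + 1) (c + + 1)) p∣c²-1))

module RingFromLaws where

  open import Level using (0ℓ)
  open import Algebra.Bundles using (CommutativeRing)
  open import Relation.Binary.Structures using (IsEquivalence)
  open import Relation.Binary.PropositionalEquality using (_≡_; refl)
  open import Data.Product using (_,_)

  -- The data of a commutative ring whose operations satisfy the ring laws on the nose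
  -- (as propositional equalities) and respect a coarser equivalence ≈.  The rings
  -- (ℤ/n)[x]/(x² - a x - b) and (ℤ/n)[ζ]/(ζ⁷ - 1) used below arise this way: the laws
  -- hold already for integer coefficients, while ≈ is congruence modulo n.
  record RingLaws : Set₁ where
    field
      Carrier : Set
      _≈_ : Carrier → Carrier → Set
      isEquivalence : IsEquivalence _≈_
      _⊕_ _⊗_ : Carrier → Carrier → Carrier
      ⊖_ : Carrier → Carrier
      𝟘 𝟙 : Carrier
      ⊕-cong : ∀ {x y x' y'} → x ≈ x' → y ≈ y' → (x ⊕ y) ≈ (x' ⊕ y')
      ⊗-cong : ∀ {x y x' y'} → x ≈ x' → y ≈ y' → (x ⊗ y) ≈ (x' ⊗ y')
      ⊖-cong : ∀ {x x'} → x ≈ x' → (⊖ x) ≈ (⊖ x')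
      ⊕-assoc : ∀ x y z → ((x ⊕ y) ⊕ z) ≡ (x ⊕ (y ⊕ z))
      ⊕-comm : ∀ x y → (x ⊕ y) ≡ (y ⊕ x)
      ⊕-identityˡ : ∀ x → (𝟘 ⊕ x) ≡ x
      ⊕-identityʳ : ∀ x → (x ⊕ 𝟘) ≡ x
      ⊖-inverseˡ : ∀ x → ((⊖ x) ⊕ x) ≡ 𝟘
      ⊖-inverseʳ : ∀ x → (x ⊕ (⊖ x)) ≡ 𝟘
      ⊗-assoc : ∀ x y z → ((x ⊗ y) ⊗ z) ≡ (x ⊗ (y ⊗ z))
      ⊗-comm : ∀ x y → (x ⊗ y) ≡ (y ⊗ x)
      ⊗-identityˡ : ∀ x → (𝟙 ⊗ x) ≡ x
      ⊗-identityʳ : ∀ x → (x ⊗ 𝟙) ≡ x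
      distribˡ : ∀ x y z → (x ⊗ (y ⊕ z)) ≡ ((x ⊗ y) ⊕ (x ⊗ z))
      distribʳ : ∀ x y z → ((y ⊕ z) ⊗ x) ≡ ((y ⊗ x) ⊕ (z ⊗ x))

  toCommutativeRing : RingLaws → CommutativeRing 0ℓ 0ℓ
  toCommutativeRing D = record
    { Carrier = Carrier ; _≈_ = _≈_ ; _+_ = _⊕_ ; _*_ = _⊗_ ; -_ = ⊖_ ; 0# = 𝟘 ; 1# = 𝟙
    ; isCommutativeRing = record
      { isRing = record
        { +-isAbelianGroup = record
          { isGroup = record
            { isMonoid = record
              { isSemigroup = record
                { isMagma = record { isEquivalence = isEquivalence ; ∙-cong = ⊕-cong }
                ; assoc = λ x y z → ≈-refl (⊕-assoc x y z) }
              ; identity = (λ x → ≈-refl (⊕-identityˡ x)) , (λ x → ≈-refl (⊕-identityʳ x)) }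
            ; inverse = (λ x → ≈-refl (⊖-inverseˡ x)) , (λ x → ≈-refl (⊖-inverseʳ x))
            ; ⁻¹-cong = ⊖-cong }
          ; comm = λ x y → ≈-refl (⊕-comm x y) }
        ; *-cong = ⊗-cong
        ; *-assoc = λ x y z → ≈-refl (⊗-assoc x y z)
        ; *-identity = (λ x → ≈-refl (⊗-identityˡ x)) , (λ x → ≈-refl (⊗-identityʳ x))
        ; distrib = (λ x y z → ≈-refl (distribˡ x y z)) , (λ x y z → ≈-refl (distribʳ x y z)) }
      ; *-comm = λ x y → ≈-refl (⊗-comm x y) } }
    where
      open RingLaws D
      ≈-refl : ∀ {x y} → x ≡ y → x ≈ y
      ≈-refl refl = IsEquivalence.refl isEquivalence

module Arithmetic where

  open import Data.Nat
  open import Data.Nat.Properties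
  open import Data.Nat.Divisibility
  open import Data.Nat.Coprimality using (Coprime; coprime-divisor)
  open import Data.Nat.Primality using (Prime; prime?; Composite; ¬prime⇒composite; _Rough_; rough∧square>⇒prime)
  open import Data.Nat.Induction using (<-rec)
  open import Data.Product using (Σ; _×_; _,_)
  open import Relation.Nullary using (¬_; yes; no)
  open import Relation.Binary.PropositionalEquality
  open import Data.Empty using (⊥-elim)
  open import Data.Nat.Tactic.RingSolver using (solve-∀)

  primeFactor : ∀ n → 1 < n → Σ ℕ λ p → Prime p × p ∣ n
  primeFactor = <-rec _ go
    where
      go : ∀ n → (∀ {m} → m < n → 1 < m → Σ ℕ λ p → Prime p × p ∣ m) → 1 < n → Σ ℕ λ p → Prime p × p ∣ n
      go n rec 1<n with prime? n
      ... | yes n-prime = n , n-prime , ∣-refl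
      ... | no ¬n-prime = fromDivisor (¬prime⇒composite ⦃ n>1⇒nonTrivial 1<n ⦄ ¬n-prime)
        where
          fromDivisor : Composite n → Σ ℕ λ p → Prime p × p ∣ n
          fromDivisor (hasNonTrivialDivisor {d} d<n d∣n) with rec d<n (nonTrivial⇒n>1 d)
          ... | p , p-prime , p∣d = p , p-prime , ∣-trans p∣d d∣n

  prime-if-prime-factors-large : ∀ N P → 1 < N → N < P * P → (∀ p → Prime p → p ∣ N → P ≤ p) → Prime N
  prime-if-prime-factors-large N P 1<N N<P² large = rough∧square>⇒prime ⦃ n>1⇒nonTrivial 1<N ⦄ P-rough N<P²
    where
      P-rough : P Rough N
      P-rough (hasNonTrivialDivisor {d} d<P d∣N) with primeFactor d (nonTrivial⇒n>1 d)
      ... | p , p-prime , p∣d =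
        <⇒≱ (≤-<-trans (∣⇒≤ ⦃ nonTrivial⇒nonZero d ⦄ p∣d) d<P) (large p p-prime (∣-trans p∣d d∣N))

  odd-form : ∀ n → ¬ (2 ∣ n) → Σ ℕ λ v → n ≡ suc (v + v)
  odd-form zero 2∤n = ⊥-elim (2∤n (divides 0 refl))
  odd-form (suc zero) 2∤n = 0 , refl
  odd-form (suc (suc n)) 2∤n with odd-form n (λ 2∣n → 2∤n (∣m∣n⇒∣m+n (∣-refl {2}) 2∣n))
  ... | v , refl = suc v , cong (λ x → suc (suc x)) (sym (+-suc v v))

  2∤odd : ∀ v → ¬ (2 ∣ suc (v + v))
  2∤odd v 2∣odd with ∣1⇒≡1 (∣m+n∣m⇒∣n (subst (2 ∣_) (+-comm 1 (v + v)) 2∣odd) (divides v (double v)))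
    where
      double : ∀ v → v + v ≡ v * 2
      double = solve-∀
  ... | ()

  odd-coprime : ∀ {d} → ¬ (2 ∣ d) → Coprime d 2
  odd-coprime nd {zero} (_ , 0∣2) with 0∣⇒≡0 0∣2
  ... | ()
  odd-coprime nd {1} _ = refl
  odd-coprime nd {2} (2∣d , _) = ⊥-elim (nd 2∣d)
  odd-coprime nd {suc (suc (suc i))} (_ , i∣2) with ∣⇒≤ i∣2
  ... | s≤s (s≤s ())

  divisor-halves : ∀ M d k → d ∣ k * 2 ^ suc M → ¬ (2 ^ suc M ∣ d) → d ∣ k * 2 ^ M
  divisor-halves M d k d∣ nd with 2 ∣? d
  ... | no 2∤d = coprime-divisor (odd-coprime 2∤d) (subst (d ∣_) (shift k (2 ^ M)) d∣)
    where
      shift : ∀ k x → k * (2 * x) ≡ 2 * (k * x)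
      shift = solve-∀
  divisor-halves zero d k d∣ nd | yes 2∣d = ⊥-elim (nd 2∣d)
  divisor-halves (suc M) d k d∣ nd | yes (divides a refl) =
    subst (_∣ k * 2 ^ suc M) (*-comm 2 a) (subst (2 * a ∣_) (sym (shift k (2 ^ M))) (*-monoʳ-∣ 2 a∣))
    where
      shift : ∀ k x → k * (2 * x) ≡ 2 * (k * x)
      shift = solve-∀
      shift² : ∀ k x → k * (2 * (2 * x)) ≡ 2 * (k * (2 * x))
      shift² = solve-∀
      a∣ : a ∣ k * 2 ^ M
      a∣ = divisor-halves M a k
             (*-cancelˡ-∣ 2 (subst (2 * a ∣_) (shift² k (2 ^ M)) (subst (_∣ k * 2 ^ suc (suc M)) (*-comm a 2) d∣)))
             (λ 2^M+1∣a → nd (subst (2 * 2 ^ suc M ∣_) (*-comm 2 a) (*-monoʳ-∣ 2 2^M+1∣a)))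

  -- Let P = 2X and k = 2a + 1 < P.  Then P - 1 is not a divisor p ≥ 2 of k P + 1: modulo
  -- p = P - 1 we have k P + 1 ≡ k + 1, and p | k + 1 ≤ p + 1 forces k + 1 = p, which is
  -- impossible as k + 1 is even and p is odd.
  no-factor-one-below : ∀ a X p → 1 < p → suc (a + a) < X + X → X + X ≡ suc p → ¬ (p ∣ suc (a + a) * (X + X) + 1)
  no-factor-one-below a X p 1<p k<P P≡p+1 p∣N = 2∤odd (suc a) (subst (2 ∣_) P≡k+2 (divides X (double X)))
    where
      k = suc (a + a)
      regroup : ∀ k p → k * suc p + 1 ≡ k * p + (k + 1)
      regroup = solve-∀
      double : ∀ x → x + x ≡ x * 2
      double = solve-∀
      p∣k+1 : p ∣ k + 1
      p∣k+1 = ∣m+n∣m⇒∣n (subst (p ∣_) (regroup k p) (subst (λ P → p ∣ k * P + 1) P≡p+1 p∣N)) (n∣m*n k)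
      k+1≢p+1 : k + 1 ≢ suc p
      k+1≢p+1 k+1≡p+1 = <⇒≢ 1<p (sym (∣1⇒≡1 (∣m+n∣m⇒∣n (subst (p ∣_) (trans k+1≡p+1 (+-comm 1 p)) p∣k+1) ∣-refl)))
      k+1≡p : k + 1 ≡ p
      k+1≡p = ≤-antisym (≤-pred (≤∧≢⇒< (subst (k + 1 ≤_) P≡p+1 (subst (_≤ X + X) (+-comm 1 k) k<P)) k+1≢p+1))
                        (∣⇒≤ ⦃ subst NonZero (+-comm 1 k) _ ⦄ p∣k+1)
      P≡k+2 : X + X ≡ suc (suc a + suc a)
      P≡k+2 = trans P≡p+1 (cong suc (trans (sym k+1≡p) (trans (+-comm k 1) (cong suc (sym (+-suc a a))))))

  proth-bound : ∀ k P → 1 < P → k < P → k * P + 1 < P * P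
  proth-bound k P 1<P k<P = begin-strict
    k * P + 1    <⟨ +-monoʳ-< (k * P) 1<P ⟩
    k * P + P    ≡⟨ +-comm (k * P) P ⟩
    suc k * P    ≤⟨ *-monoˡ-≤ P k<P ⟩
    P * P        ∎
    where open ≤-Reasoning

module RingFacts (R : CommutativeRing 0ℓ 0ℓ) where
  open import Algebra.Bundles using (CommutativeRing)
  open import Data.Nat as ℕ using (ℕ; zero; suc)
  import Data.Nat.Properties as ℕP
  open import Data.Nat.Divisibility using (_∣_; divides; _∣?_; ∣-trans)
  open import Data.Nat.GCD using (module Bézout; gcd; GCD; gcd-GCD; gcd[m,n]∣m; gcd[m,n]∣n)
  open import Relation.Nullary using (¬_; yes; no)
  open import Data.Empty using (⊥-elim)
  open import Data.Maybe using (nothing)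
  open import Relation.Binary.PropositionalEquality as ≡ using (_≡_)
  open import Data.Nat.Tactic.RingSolver using (solve-∀)
  open Arithmetic using (divisor-halves)

  open CommutativeRing R
  open import Algebra.Properties.Semiring.Exp semiring public
  open import Algebra.Properties.CommutativeSemiring.Exp commutativeSemiring public using (^-distrib-*)
  open import Algebra.Properties.Ring ring using (-1*x≈-x; -‿involutive)
  open import Algebra.Solver.Ring.NaturalCoefficients commutativeSemiring (λ _ _ → nothing)
  open import Relation.Binary.Reasoning.Setoid setoid

  +-cancelʳ : ∀ {x y} c → x + c ≈ y + c → x ≈ y
  +-cancelʳ {x} {y} c e = begin
    x               ≈⟨ +-identityʳ x ⟨
    x + 0#          ≈⟨ +-congˡ (-‿inverseʳ c) ⟨
    x + (c + - c)   ≈⟨ +-assoc x c (- c) ⟨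
    (x + c) + - c   ≈⟨ +-congʳ e ⟩
    (y + c) + - c   ≈⟨ +-assoc y c (- c) ⟩
    y + (c + - c)   ≈⟨ +-congˡ (-‿inverseʳ c) ⟩
    y + 0#          ≈⟨ +-identityʳ y ⟩
    y               ∎

  *-cancelˡ-unit : ∀ {x y} h t → h * t ≈ 1# → t * x ≈ t * y → x ≈ y
  *-cancelˡ-unit {x} {y} h t ht e = begin
    x             ≈⟨ *-identityˡ x ⟨
    1# * x        ≈⟨ *-congʳ ht ⟨
    (h * t) * x   ≈⟨ *-assoc h t x ⟩
    h * (t * x)   ≈⟨ *-congˡ e ⟩
    h * (t * y)   ≈⟨ *-assoc h t y ⟨
    (h * t) * y   ≈⟨ *-congʳ ht ⟩
    1# * y        ≈⟨ *-identityˡ y ⟩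
    y             ∎

  -- The polynomial identities behind the Lucas recurrences V(k+2) = P V(k+1) - Q V(k)
  -- and S(j+1) = S(j)² - 2.
  lucas-identity : ∀ A B X Y → (A + B) * (A * X + B * Y) ≈ (A * (A * X) + B * (B * Y)) + (A * B) * (X + Y)
  lucas-identity = solve 4 (λ A B X Y →
    (A :+ B) :* (A :* X :+ B :* Y) := (A :* (A :* X) :+ B :* (B :* Y)) :+ (A :* B) :* (X :+ Y)) refl

  square-identity : ∀ X Y → (X + Y) * (X + Y) ≈ (X * X + Y * Y) + (1# + 1#) * (X * Y)
  square-identity = solve 2 (λ X Y → (X :+ Y) :* (X :+ Y) := (X :* X :+ Y :* Y) :+ con 2 :* (X :* Y)) refl

  subtract : ∀ {x y z} → x ≈ y + z → x - z ≈ y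
  subtract {x} {y} {z} e = begin
    x - z             ≈⟨ +-congʳ e ⟩
    (y + z) + - z     ≈⟨ +-assoc y z (- z) ⟩
    y + (z + - z)     ≈⟨ +-congˡ (-‿inverseʳ z) ⟩
    y + 0#            ≈⟨ +-identityʳ y ⟩
    y                 ∎

  1^ : ∀ n → 1# ^ n ≈ 1#
  1^ zero = refl
  1^ (suc n) = trans (*-identityˡ _) (1^ n)

  inverse-^ : ∀ x y → x * y ≈ 1# → ∀ n → x ^ n * y ^ n ≈ 1#
  inverse-^ x y xy n = trans (sym (^-distrib-* x y n)) (trans (^-congˡ n xy) (1^ n))

  ^-double : ∀ x u → x ^ (u ℕ.+ u) ≈ (x * x) ^ u
  ^-double x u = trans (^-homo-* x u u) (sym (^-distrib-* x x u))

  ^-odd : ∀ x u → x ^ suc (u ℕ.+ u) ≈ x * (x * x) ^ u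
  ^-odd x u = *-congˡ (^-double x u)

  -- If x³ = c x then x^(2u+1) = c^u x (in particular when x² = c): the shape of
  -- Euler's criterion.
  ^-odd-eigen : ∀ x c → x * x * x ≈ c * x → ∀ u → x ^ suc (u ℕ.+ u) ≈ c ^ u * x
  ^-odd-eigen x c xxx zero = trans (*-identityʳ x) (sym (*-identityˡ x))
  ^-odd-eigen x c xxx (suc u) = begin
    x ^ suc (suc u ℕ.+ suc u)       ≡⟨ ≡.cong (λ j → x ^ suc (suc j)) (ℕP.+-suc u u) ⟩
    x * (x * (x * x ^ (u ℕ.+ u)))   ≈⟨ *-assoc x x _ ⟨
    (x * x) * x ^ suc (u ℕ.+ u)     ≈⟨ *-congˡ (^-odd-eigen x c xxx u) ⟩
    (x * x) * (c ^ u * x)           ≈⟨ *-congˡ (*-comm _ x) ⟩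
    (x * x) * (x * c ^ u)           ≈⟨ *-assoc (x * x) x _ ⟨
    (x * x * x) * c ^ u             ≈⟨ *-congʳ xxx ⟩
    (c * x) * c ^ u                 ≈⟨ *-assoc c x _ ⟩
    c * (x * c ^ u)                 ≈⟨ *-congˡ (*-comm x _) ⟩
    c * (c ^ u * x)                 ≈⟨ *-assoc c _ x ⟨
    c ^ suc u * x                   ∎

  ^-period : ∀ z m → z ^ m ≈ 1# → ∀ a b → z ^ (m ℕ.* a ℕ.+ b) ≈ z ^ b
  ^-period z m zm a b = begin
    z ^ (m ℕ.* a ℕ.+ b)     ≈⟨ ^-homo-* z (m ℕ.* a) b ⟩
    z ^ (m ℕ.* a) * z ^ b   ≈⟨ *-congʳ (^-assocʳ z m a) ⟨
    (z ^ m) ^ a * z ^ b     ≈⟨ *-congʳ (^-congˡ a zm) ⟩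
    1# ^ a * z ^ b          ≈⟨ *-congʳ (1^ a) ⟩
    1# * z ^ b              ≈⟨ *-identityˡ _ ⟩
    z ^ b                   ∎

  ^-multiple : ∀ z m → z ^ m ≈ 1# → ∀ a → z ^ (m ℕ.* a) ≈ 1#
  ^-multiple z m zm a = trans (^-congʳ z (≡.sym (ℕP.+-identityʳ (m ℕ.* a)))) (^-period z m zm a 0)

  ^-divisor : ∀ z m n → z ^ m ≈ 1# → m ∣ n → z ^ n ≈ 1#
  ^-divisor z m n zm (divides q ≡.refl) = trans (^-congʳ z (ℕP.*-comm q m)) (^-multiple z m zm q)

  ^-combination : ∀ z d a x b y → z ^ a ≈ 1# → z ^ b ≈ 1# → d ℕ.+ a ℕ.* x ≡ b ℕ.* y → z ^ d ≈ 1#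
  ^-combination z d a x b y za zb eq = begin
    z ^ d                   ≈⟨ *-identityʳ _ ⟨
    z ^ d * 1#              ≈⟨ *-congˡ (^-multiple z a za x) ⟨
    z ^ d * z ^ (a ℕ.* x)   ≈⟨ ^-homo-* z d _ ⟨
    z ^ (d ℕ.+ a ℕ.* x)     ≡⟨ ≡.cong (z ^_) eq ⟩
    z ^ (b ℕ.* y)           ≈⟨ ^-multiple z b zb y ⟩
    1#                      ∎

  ^-gcd : ∀ z a b → z ^ a ≈ 1# → z ^ b ≈ 1# → ∀ d → GCD a b d → z ^ d ≈ 1#
  ^-gcd z a b za zb d g with Bézout.identity g
  ... | Bézout.Identity.+- x y eq = ^-combination z d b y a x zb za
          (≡.trans (≡.cong (d ℕ.+_) (ℕP.*-comm b y)) (≡.trans eq (ℕP.*-comm x a)))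
  ... | Bézout.Identity.-+ x y eq = ^-combination z d a x b y za zb
          (≡.trans (≡.cong (d ℕ.+_) (ℕP.*-comm a x)) (≡.trans eq (ℕP.*-comm y b)))

  -- If z^(k·2^M) = -1 ≠ 1, then 2^(M+1) divides every exponent e with z^e = 1:
  -- otherwise gcd(e, k·2^(M+1)) would divide k·2^M, forcing z^(k·2^M) = 1.
  two-adic-order : ∀ z e k M → ¬ (- 1# ≈ 1#) → z ^ e ≈ 1# → z ^ (k ℕ.* 2 ℕ.^ M) ≈ - 1# →
                   2 ℕ.^ suc M ∣ e
  two-adic-order z e k M -1≉1 ze zT with 2 ℕ.^ suc M ∣? e
  ... | yes 2^M+1∣e = 2^M+1∣e
  ... | no 2^M+1∤e = ⊥-elim (-1≉1 (trans (sym zT) (^-divisor z G T zG G∣T)))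
    where
      T = k ℕ.* 2 ℕ.^ M
      2T = k ℕ.* 2 ℕ.^ suc M
      doubling : ∀ k x → k ℕ.* (2 ℕ.* x) ≡ k ℕ.* x ℕ.+ k ℕ.* x
      doubling = solve-∀
      z2T : z ^ 2T ≈ 1#
      z2T = begin
        z ^ 2T              ≡⟨ ≡.cong (z ^_) (doubling k (2 ℕ.^ M)) ⟩
        z ^ (T ℕ.+ T)       ≈⟨ ^-homo-* z T T ⟩
        z ^ T * z ^ T       ≈⟨ *-cong zT zT ⟩
        - 1# * - 1#         ≈⟨ -1*x≈-x (- 1#) ⟩
        - (- 1#)            ≈⟨ -‿involutive 1# ⟩
        1#                  ∎
      G = gcd e 2T
      zG : z ^ G ≈ 1#
      zG = ^-gcd z e 2T ze z2T G (gcd-GCD e 2T)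
      G∣T : G ∣ T
      G∣T = divisor-halves M G k (gcd[m,n]∣n e 2T) (λ 2^M+1∣G → 2^M+1∤e (∣-trans 2^M+1∣G (gcd[m,n]∣m e 2T)))

module Frobenius where

  open import Level using (0ℓ)
  open import Algebra.Bundles using (CommutativeRing)
  open import Data.Nat as ℕ using (ℕ; zero; suc; _<_; z≤n; s≤s; _∸_; _!)
  import Data.Nat.Properties as ℕP
  open import Data.Nat.Divisibility using (_∣_; divides; ∣1⇒≡1; ∣⇒≤; m∣m*n)
  open import Data.Nat.DivMod using (m/n*n≡m)
  open import Data.Nat.Primality using (Prime; euclidsLemma; prime⇒nonTrivial)
  open import Data.Nat.Combinatorics using (_C_; nCn≡1; nCk≡nC[n∸k]; nCk≡n!/k![n-k]!; k![n∸k]!∣n!)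
  open import Data.Fin as Fin using (toℕ; inject₁; fromℕ)
  open import Data.Fin.Properties using (toℕ-fromℕ; toℕ-inject₁; toℕ<n)
  open import Data.Sum using (inj₁; inj₂)
  open import Data.Empty using (⊥-elim)
  open import Relation.Nullary using (¬_)
  open import Relation.Binary.PropositionalEquality as ≡ using (_≡_)

  prime>1 : ∀ {p} → Prime p → 1 < p
  prime>1 {p} p-prime = ℕ.nonTrivial⇒n>1 p ⦃ prime⇒nonTrivial p-prime ⦄

  prime∤factorial : ∀ {p} → Prime p → ∀ j → j < p → ¬ p ∣ j !
  prime∤factorial p-prime zero j<p p∣1 with ∣1⇒≡1 p∣1
  ... | ≡.refl = ℕP.<-irrefl ≡.refl (prime>1 p-prime)
  prime∤factorial p-prime (suc j) j<p p∣j! with euclidsLemma (suc j) (j !) p-prime p∣j!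
  ... | inj₁ p∣1+j = ℕP.<⇒≱ j<p (∣⇒≤ p∣1+j)
  ... | inj₂ p∣j! = prime∤factorial p-prime j (ℕP.<-trans (ℕP.n<1+n j) j<p) p∣j!

  -- p divides the inner binomial coefficients C(p,k), 0 < k < p: it divides
  -- p! = C(p,k) k! (p-k)! but neither k! nor (p-k)!.
  prime∣binomial : ∀ {p k} → Prime p → 0 < k → k < p → p ∣ p C k
  prime∣binomial {p} {k} p-prime 0<k k<p = p∣C
    where
      instance _ = ℕP._!*_!≢0 k (p ∸ k)
      k≤p = ℕP.<⇒≤ k<p
      D = k ! ℕ.* (p ∸ k) !
      factorisation : (p C k) ℕ.* D ≡ p !
      factorisation = ≡.trans (≡.cong (ℕ._* D) (nCk≡n!/k![n-k]! k≤p)) (m/n*n≡m (k![n∸k]!∣n! k≤p))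
      p∣p! : p ∣ p !
      p∣p! with prime>1 p-prime
      ... | s≤s _ = m∣m*n _
      p∣C : p ∣ p C k
      p∣C with euclidsLemma (p C k) D p-prime (≡.subst (p ∣_) (≡.sym factorisation) p∣p!)
      ... | inj₁ p∣C = p∣C
      ... | inj₂ p∣D with euclidsLemma (k !) ((p ∸ k) !) p-prime p∣D
      ...   | inj₁ p∣k! = ⊥-elim (prime∤factorial p-prime k k<p p∣k!)
      ...   | inj₂ p∣[p-k]! = ⊥-elim (prime∤factorial p-prime (p ∸ k) (ℕP.∸-monoʳ-< 0<k k≤p) p∣[p-k]!)

  module PrimeCharacteristic (R : CommutativeRing 0ℓ 0ℓ) where
    open CommutativeRing R
    open import Algebra.Properties.Semiring.Mult semiring using (×-assoc-*)
    open import Algebra.Properties.Monoid.Mult +-monoid using (_×_; ×-assocˡ; ×-congʳ; ×-congˡ; ×-homo-1)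
    open RingFacts R using (_^_; ^-congˡ; 1^)
    open import Algebra.Properties.CommutativeSemiring.Binomial commutativeSemiring using (theorem; binomialTerm; binomialExpansion)
    open import Algebra.Properties.Monoid.Sum +-monoid using (sum; sum-init-last; sum-cong-≋; sum-replicate-zero)
    open import Algebra.Properties.Group +-group using (inverseʳ-unique)
    open import Relation.Binary.Reasoning.Setoid setoid

    ×-zero : ∀ c → c × 0# ≈ 0#
    ×-zero zero = refl
    ×-zero (suc c) = trans (+-identityˡ _) (×-zero c)

    module _ (p : ℕ) (p-prime : Prime p) (char : p × 1# ≈ 0#) where

      p×≈0 : ∀ z → p × z ≈ 0#
      p×≈0 z = begin
        p × z          ≈⟨ ×-congʳ p (*-identityˡ z) ⟨
        p × (1# * z)   ≈⟨ ×-assoc-* p 1# z ⟨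
        (p × 1#) * z   ≈⟨ *-congʳ char ⟩
        0# * z         ≈⟨ zeroˡ z ⟩
        0#             ∎

      binomial×≈0 : ∀ {k} z → 0 < k → k < p → (p C k) × z ≈ 0#
      binomial×≈0 {k} z 0<k k<p with prime∣binomial p-prime 0<k k<p
      ... | divides c eq = begin
        (p C k) × z    ≈⟨ ×-congˡ eq ⟩
        (c ℕ.* p) × z  ≈⟨ ×-assocˡ z c p ⟨
        c × (p × z)    ≈⟨ ×-congʳ c (p×≈0 z) ⟩
        c × 0#         ≈⟨ ×-zero c ⟩
        0#             ∎

      freshman : ∀ x y → (x + y) ^ p ≈ x ^ p + y ^ p
      freshman x y = expand p ≡.refl (prime>1 p-prime)
        where
          expand : ∀ q → q ≡ p → 1 < q → (x + y) ^ p ≈ x ^ p + y ^ p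
          expand (suc q) ≡.refl (s≤s 0<q) = begin
            (x + y) ^ p                  ≈⟨ theorem p x y ⟩
            binomialExpansion x y p      ≡⟨⟩
            t Fin.zero + sum {suc q} (λ i → t (Fin.suc i))
              ≈⟨ +-cong first (sum-init-last {q} (λ i → t (Fin.suc i))) ⟩
            y ^ p + (sum {q} (λ i → t (Fin.suc (inject₁ i))) + t (Fin.suc (fromℕ q)))
              ≈⟨ +-congˡ (+-cong middle last) ⟩
            y ^ p + (0# + x ^ p)         ≈⟨ +-congˡ (+-identityˡ _) ⟩
            y ^ p + x ^ p                ≈⟨ +-comm _ _ ⟩
            x ^ p + y ^ p                ∎
            where
              t = binomialTerm x y p
              first : t Fin.zero ≈ y ^ p
              first = begin
                (p C 0) × (1# * y ^ p) ≈⟨ ×-congˡ (≡.trans (nCk≡nC[n∸k] {0} {p} z≤n) (nCn≡1 p)) ⟩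
                1 × (1# * y ^ p)       ≈⟨ ×-homo-1 _ ⟩
                1# * y ^ p             ≈⟨ *-identityˡ _ ⟩
                y ^ p                  ∎
              last : t (Fin.suc (fromℕ q)) ≈ x ^ p
              last = begin
                (p C suc (toℕ (fromℕ q))) × (x ^ suc (toℕ (fromℕ q)) * y ^ (q ∸ toℕ (fromℕ q)))
                  ≡⟨ ≡.cong (λ j → (p C suc j) × (x ^ suc j * y ^ (q ∸ j))) (toℕ-fromℕ q) ⟩
                (p C p) × (x ^ p * y ^ (q ∸ q)) ≈⟨ ×-congˡ (nCn≡1 p) ⟩
                1 × (x ^ p * y ^ (q ∸ q))       ≈⟨ ×-homo-1 _ ⟩
                x ^ p * y ^ (q ∸ q)             ≡⟨ ≡.cong (λ j → x ^ p * y ^ j) (ℕP.n∸n≡0 q) ⟩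
                x ^ p * 1#                      ≈⟨ *-identityʳ _ ⟩
                x ^ p                           ∎
              middle : sum {q} (λ i → t (Fin.suc (inject₁ i))) ≈ 0#
              middle = trans (sum-cong-≋ {q} {y = λ _ → 0#} (λ i → binomial×≈0 _ (s≤s z≤n)
                               (s≤s (ℕP.≤-trans (ℕP.≤-reflexive (≡.cong suc (toℕ-inject₁ i))) (toℕ<n i)))))
                             (sum-replicate-zero q)

      0^p : 0# ^ p ≈ 0#
      0^p with prime>1 p-prime
      ... | s≤s _ = zeroˡ _

      freshman-neg : ∀ x → (- x) ^ p ≈ - (x ^ p)
      freshman-neg x = inverseʳ-unique (x ^ p) ((- x) ^ p) (begin
        x ^ p + (- x) ^ p  ≈⟨ freshman x (- x) ⟨
        (x + - x) ^ p      ≈⟨ ^-congˡ p (-‿inverseʳ x) ⟩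
        0# ^ p             ≈⟨ 0^p ⟩
        0#                 ∎)

      fermat : ∀ n → (n × 1#) ^ p ≈ n × 1#
      fermat zero = 0^p
      fermat (suc n) = begin
        (1# + n × 1#) ^ p      ≈⟨ freshman 1# (n × 1#) ⟩
        1# ^ p + (n × 1#) ^ p  ≈⟨ +-cong (1^ p) (fermat n) ⟩
        1# + n × 1#            ∎

-- The ring (ℤ/n)[x]/(x² - a x - b).  An element (u , v) stands for u + v x, so that
-- x² = a x + b; equality is coordinatewise congruence modulo n.
module QuadraticRing (n : ℕ) (a b : ℤ) where
  open import Level using (0ℓ)
  open import Algebra.Bundles using (CommutativeRing)
  open import Data.Nat as ℕ using (ℕ; zero; suc)
  open import Data.Nat.Primality using (Prime)
  open import Data.Integer as ℤ using (ℤ; +_; -[1+_]; _+_; _-_; _*_; -_)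
  import Data.Integer.Properties as ℤP
  open import Data.Integer.Tactic.RingSolver using (solve-∀)
  open import Data.Product using (_,_; proj₁; proj₂) renaming (_×_ to _∧_)
  open import Relation.Binary.PropositionalEquality as ≡ using (_≡_; cong₂)
  open import Relation.Binary.Structures using (IsEquivalence)
  open import Defs using (V; S)
  open Congruence
  open RingFromLaws

  Q : Set
  Q = ℤ ∧ ℤ

  infix 4 _≈_
  record _≈_ (x y : Q) : Set where
    constructor _&_
    field
      ≈₀ : proj₁ x ≡[ n ] proj₁ y
      ≈₁ : proj₂ x ≡[ n ] proj₂ y
  open _≈_ public

  infixl 6 _⊕_
  infixl 7 _⊗_
  infix 8 ⊖_
  _⊕_ : Q → Q → Q
  (u , v) ⊕ (u' , v') = (u + u' , v + v')
  _⊗_ : Q → Q → Q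
  (u , v) ⊗ (u' , v') = (u * u' + b * (v * v') , u * v' + v * u' + a * (v * v'))
  ⊖_ : Q → Q
  ⊖ (u , v) = (- u , - v)

  𝟘 𝟙 : Q
  𝟘 = (+ 0 , + 0)
  𝟙 = (+ 1 , + 0)

  private
    ⊗-assoc₀ : ∀ (u v u' v' u'' v'' a b : ℤ) →
      (u * u' + b * (v * v')) * u'' + b * ((u * v' + v * u' + a * (v * v')) * v'')
      ≡ u * (u' * u'' + b * (v' * v'')) + b * (v * (u' * v'' + v' * u'' + a * (v' * v'')))
    ⊗-assoc₀ = solve-∀
    ⊗-assoc₁ : ∀ (u v u' v' u'' v'' a b : ℤ) →
      (u * u' + b * (v * v')) * v'' + (u * v' + v * u' + a * (v * v')) * u'' + a * ((u * v' + v * u' + a * (v * v')) * v'')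
      ≡ u * (u' * v'' + v' * u'' + a * (v' * v'')) + v * (u' * u'' + b * (v' * v'')) + a * (v * (u' * v'' + v' * u'' + a * (v' * v'')))
    ⊗-assoc₁ = solve-∀
    ⊗-comm₀ : ∀ (u v u' v' a b : ℤ) → u * u' + b * (v * v') ≡ u' * u + b * (v' * v)
    ⊗-comm₀ = solve-∀
    ⊗-comm₁ : ∀ (u v u' v' a b : ℤ) → u * v' + v * u' + a * (v * v') ≡ u' * v + v' * u + a * (v' * v)
    ⊗-comm₁ = solve-∀
    ⊗-identityˡ₀ : ∀ (u v a b : ℤ) → + 1 * u + b * (+ 0 * v) ≡ u
    ⊗-identityˡ₀ = solve-∀
    ⊗-identityˡ₁ : ∀ (u v a b : ℤ) → + 1 * v + + 0 * u + a * (+ 0 * v) ≡ v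
    ⊗-identityˡ₁ = solve-∀
    ⊗-identityʳ₀ : ∀ (u v a b : ℤ) → u * + 1 + b * (v * + 0) ≡ u
    ⊗-identityʳ₀ = solve-∀
    ⊗-identityʳ₁ : ∀ (u v a b : ℤ) → u * + 0 + v * + 1 + a * (v * + 0) ≡ v
    ⊗-identityʳ₁ = solve-∀
    distribˡ₀ : ∀ (u v u' v' u'' v'' a b : ℤ) →
      u * (u' + u'') + b * (v * (v' + v'')) ≡ (u * u' + b * (v * v')) + (u * u'' + b * (v * v''))
    distribˡ₀ = solve-∀
    distribˡ₁ : ∀ (u v u' v' u'' v'' a b : ℤ) →
      u * (v' + v'') + v * (u' + u'') + a * (v * (v' + v'')) ≡ (u * v' + v * u' + a * (v * v')) + (u * v'' + v * u'' + a * (v * v''))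
    distribˡ₁ = solve-∀
    distribʳ₀ : ∀ (u v u' v' u'' v'' a b : ℤ) →
      (u' + u'') * u + b * ((v' + v'') * v) ≡ (u' * u + b * (v' * v)) + (u'' * u + b * (v'' * v))
    distribʳ₀ = solve-∀
    distribʳ₁ : ∀ (u v u' v' u'' v'' a b : ℤ) →
      (u' + u'') * v + (v' + v'') * u + a * ((v' + v'') * v) ≡ (u' * v + v' * u + a * (v' * v)) + (u'' * v + v'' * u + a * (v'' * v))
    distribʳ₁ = solve-∀

  ≈-isEquivalence : IsEquivalence _≈_
  ≈-isEquivalence = record
    { refl = ≡ₙ-refl & ≡ₙ-refl
    ; sym = λ (p & q) → ≡ₙ-sym p & ≡ₙ-sym q
    ; trans = λ (p & q) (p' & q') → ≡ₙ-trans p p' & ≡ₙ-trans q q' }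

  laws : RingLaws
  laws = record
    { Carrier = Q ; _≈_ = _≈_ ; isEquivalence = ≈-isEquivalence
    ; _⊕_ = _⊕_ ; _⊗_ = _⊗_ ; ⊖_ = ⊖_ ; 𝟘 = 𝟘 ; 𝟙 = 𝟙
    ; ⊕-cong = λ (p₀ & p₁) (q₀ & q₁) → ≡ₙ-+ p₀ q₀ & ≡ₙ-+ p₁ q₁
    ; ⊗-cong = λ (p₀ & p₁) (q₀ & q₁) →
        ≡ₙ-+ (≡ₙ-* p₀ q₀) (≡ₙ-* (≡ₙ-refl {x = b}) (≡ₙ-* p₁ q₁)) &
        ≡ₙ-+ (≡ₙ-+ (≡ₙ-* p₀ q₁) (≡ₙ-* p₁ q₀)) (≡ₙ-* (≡ₙ-refl {x = a}) (≡ₙ-* p₁ q₁))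
    ; ⊖-cong = λ (p₀ & p₁) → ≡ₙ-neg p₀ & ≡ₙ-neg p₁
    ; ⊕-assoc = λ (x₀ , x₁) (y₀ , y₁) (z₀ , z₁) → cong₂ _,_ (ℤP.+-assoc x₀ y₀ z₀) (ℤP.+-assoc x₁ y₁ z₁)
    ; ⊕-comm = λ (x₀ , x₁) (y₀ , y₁) → cong₂ _,_ (ℤP.+-comm x₀ y₀) (ℤP.+-comm x₁ y₁)
    ; ⊕-identityˡ = λ (x₀ , x₁) → cong₂ _,_ (ℤP.+-identityˡ x₀) (ℤP.+-identityˡ x₁)
    ; ⊕-identityʳ = λ (x₀ , x₁) → cong₂ _,_ (ℤP.+-identityʳ x₀) (ℤP.+-identityʳ x₁)
    ; ⊖-inverseˡ = λ (x₀ , x₁) → cong₂ _,_ (ℤP.+-inverseˡ x₀) (ℤP.+-inverseˡ x₁)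
    ; ⊖-inverseʳ = λ (x₀ , x₁) → cong₂ _,_ (ℤP.+-inverseʳ x₀) (ℤP.+-inverseʳ x₁)
    ; ⊗-assoc = λ (u , v) (u' , v') (u'' , v'') →
        cong₂ _,_ (⊗-assoc₀ u v u' v' u'' v'' a b) (⊗-assoc₁ u v u' v' u'' v'' a b)
    ; ⊗-comm = λ (u , v) (u' , v') → cong₂ _,_ (⊗-comm₀ u v u' v' a b) (⊗-comm₁ u v u' v' a b)
    ; ⊗-identityˡ = λ (u , v) → cong₂ _,_ (⊗-identityˡ₀ u v a b) (⊗-identityˡ₁ u v a b)
    ; ⊗-identityʳ = λ (u , v) → cong₂ _,_ (⊗-identityʳ₀ u v a b) (⊗-identityʳ₁ u v a b)
    ; distribˡ = λ (u , v) (u' , v') (u'' , v'') →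
        cong₂ _,_ (distribˡ₀ u v u' v' u'' v'' a b) (distribˡ₁ u v u' v' u'' v'' a b)
    ; distribʳ = λ (u , v) (u' , v') (u'' , v'') →
        cong₂ _,_ (distribʳ₀ u v u' v' u'' v'' a b) (distribʳ₁ u v u' v' u'' v'' a b)
    }

  ring : CommutativeRing 0ℓ 0ℓ
  ring = toCommutativeRing laws

  open CommutativeRing ring public
    using (setoid; refl; sym; trans; reflexive; +-cong; *-cong; -‿cong; +-congˡ; +-congʳ;
           *-congˡ; *-congʳ; *-identityʳ; *-identityˡ; *-assoc; *-comm; +-comm;
           -‿inverseʳ; -‿inverseˡ; +-identityʳ; zeroʳ; distribˡ)
  open RingFacts ring public
  open import Algebra.Properties.Monoid.Mult (CommutativeRing.+-monoid ring) public using (_×_)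
  open import Relation.Binary.Reasoning.Setoid setoid

  ι : ℤ → Q
  ι z = (z , + 0)

  private
    ι-*₀ : ∀ (z w b : ℤ) → z * w ≡ z * w + b * (+ 0 * + 0)
    ι-*₀ = solve-∀
    ι-*₁ : ∀ (z w a : ℤ) → + 0 ≡ z * + 0 + + 0 * w + a * (+ 0 * + 0)
    ι-*₁ = solve-∀
    scale₀ : ∀ (x₀ x₁ z b : ℤ) → z * x₀ + b * (+ 0 * x₁) ≡ z * x₀
    scale₀ = solve-∀
    scale₁ : ∀ (x₀ x₁ z a : ℤ) → z * x₁ + + 0 * x₀ + a * (+ 0 * x₁) ≡ z * x₁
    scale₁ = solve-∀

  ι-* : ∀ z w → ι (z * w) ≈ ι z ⊗ ι w
  ι-* z w = reflexive (cong₂ _,_ (ι-*₀ z w b) (ι-*₁ z w a))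

  ι-^ : ∀ z k → ι (z ℤ.^ k) ≈ ι z ^ k
  ι-^ z zero = refl
  ι-^ z (suc k) = trans (ι-* z (z ℤ.^ k)) (*-congˡ {ι z} (ι-^ z k))

  ι-× : ∀ k → k × 𝟙 ≈ ι (+ k)
  ι-× zero = refl
  ι-× (suc k) = +-congˡ {𝟙} (ι-× k)

  ι-cong : ∀ {z w} → z ≡[ n ] w → ι z ≈ ι w
  ι-cong e = e & ≡ₙ-refl

  ι-scale : ∀ z X → ι z ⊗ X ≈ (z * proj₁ X , z * proj₂ X)
  ι-scale z (x₀ , x₁) = reflexive (cong₂ _,_ (scale₀ x₀ x₁ z b) (scale₁ x₀ x₁ z a))

  characteristic : n × 𝟙 ≈ 𝟘
  characteristic = trans (ι-× n) (ι-cong ≡ₙ-modulus)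

  ι-unit : ∀ x y q → x ℕ.* y ≡ q ℕ.* n ℕ.+ 1 → ι (+ x) ⊗ ι (+ y) ≈ 𝟙
  ι-unit x y q e = trans (sym (ι-* (+ x) (+ y)))
    (ι-cong (≡ₙ-trans (≡ₙ-reflexive (≡.sym (ℤP.pos-* x y))) (≡ₙ-from-divmod (x ℕ.* y) 1 q e)))

  lucas-V : ∀ P Q A B → A ⊕ B ≈ ι P → A ⊗ B ≈ ι Q → ∀ k → ι (V P Q k) ≈ A ^ k ⊕ B ^ k
  lucas-V P Q A B AB=P AB=Q k = proj₁ (pair k)
    where
      pair : ∀ k → (ι (V P Q k) ≈ A ^ k ⊕ B ^ k) ∧ (ι (V P Q (suc k)) ≈ A ^ suc k ⊕ B ^ suc k)
      pair zero = refl , trans (sym AB=P) (+-cong (sym (*-identityʳ A)) (sym (*-identityʳ B)))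
      pair (suc k) with pair k
      ... | Vₖ , Vₖ₊₁ = Vₖ₊₁ , (begin
        ι (P * V P Q (suc k) - Q * V P Q k)
          ≈⟨ +-cong (ι-* P _) (-‿cong (ι-* Q _)) ⟩
        ι P ⊗ ι (V P Q (suc k)) ⊕ ⊖ (ι Q ⊗ ι (V P Q k))
          ≈⟨ +-cong (*-cong (sym AB=P) Vₖ₊₁) (-‿cong (*-cong (sym AB=Q) Vₖ)) ⟩
        (A ⊕ B) ⊗ (A ⊗ A ^ k ⊕ B ⊗ B ^ k) ⊕ ⊖ ((A ⊗ B) ⊗ (A ^ k ⊕ B ^ k))
          ≈⟨ subtract (lucas-identity A B (A ^ k) (B ^ k)) ⟩
        A ^ suc (suc k) ⊕ B ^ suc (suc k) ∎)

  lucas-S : ∀ x C D → ι x ≈ C ⊕ D → C ⊗ D ≈ 𝟙 → ∀ j → ι (S j x) ≈ C ^ (2 ℕ.^ j) ⊕ D ^ (2 ℕ.^ j)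
  lucas-S x C D x=C+D CD=1 zero = trans x=C+D (sym (+-cong (*-identityʳ C) (*-identityʳ D)))
  lucas-S x C D x=C+D CD=1 (suc j) = begin
    ι (S j x * S j x - + 2)               ≈⟨ +-congʳ (ι-* (S j x) (S j x)) ⟩
    ι (S j x) ⊗ ι (S j x) ⊕ ⊖ ι (+ 2)     ≈⟨ +-congʳ (*-cong IH IH) ⟩
    (X ⊕ Y) ⊗ (X ⊕ Y) ⊕ ⊖ (𝟙 ⊕ 𝟙)
      ≈⟨ subtract square-of-sum ⟩
    X ⊗ X ⊕ Y ⊗ Y                         ≈⟨ +-cong (square C) (square D) ⟩
    C ^ (2 ℕ.^ suc j) ⊕ D ^ (2 ℕ.^ suc j) ∎
    where
      X = C ^ (2 ℕ.^ j)
      Y = D ^ (2 ℕ.^ j)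
      IH = lucas-S x C D x=C+D CD=1 j
      XY=1 : X ⊗ Y ≈ 𝟙
      XY=1 = inverse-^ C D CD=1 (2 ℕ.^ j)
      square-of-sum : (X ⊕ Y) ⊗ (X ⊕ Y) ≈ (X ⊗ X ⊕ Y ⊗ Y) ⊕ (𝟙 ⊕ 𝟙)
      square-of-sum = trans (square-identity X Y) (+-congˡ {X ⊗ X ⊕ Y ⊗ Y} (trans (*-congˡ {𝟙 ⊕ 𝟙} XY=1) (*-identityʳ (𝟙 ⊕ 𝟙))))
      square : ∀ Z → Z ^ (2 ℕ.^ j) ⊗ Z ^ (2 ℕ.^ j) ≈ Z ^ (2 ℕ.^ suc j)
      square Z = trans (sym (^-homo-* Z (2 ℕ.^ j) (2 ℕ.^ j)))
                       (^-congʳ Z (≡.cong ((2 ℕ.^ j) ℕ.+_) (≡.sym (ℕP.+-identityʳ (2 ℕ.^ j)))))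
        where import Data.Nat.Properties as ℕP

  module PrimeModulus (prime : Prime n) where
    open Frobenius.PrimeCharacteristic ring using (freshman; freshman-neg; fermat)

    frob : ∀ x y → (x ⊕ y) ^ n ≈ x ^ n ⊕ y ^ n
    frob = freshman n prime characteristic

    frob-neg : ∀ x → (⊖ x) ^ n ≈ ⊖ (x ^ n)
    frob-neg = freshman-neg n prime characteristic

    fermat-ι : ∀ z → ι z ^ n ≈ ι z
    fermat-ι (+ k) = trans (^-congˡ n (sym (ι-× k))) (trans (fermat n prime characteristic k) (ι-× k))
    fermat-ι -[1+ k ] = trans (frob-neg (ι (+ suc k))) (-‿cong (fermat-ι (+ suc k)))

module Cyclotomic where

  open import Level using (0ℓ)
  open import Algebra.Bundles using (CommutativeRing)
  open import Data.Nat using (ℕ; zero; suc)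
  open import Data.Nat.Primality using (Prime)
  open import Data.Integer as ℤ using (ℤ; +_; -[1+_]; _+_; _*_; -_)
  import Data.Integer.Properties as ℤP
  open import Data.Integer.Tactic.RingSolver using (solve-∀)
  open import Relation.Binary.PropositionalEquality as ≡ using (_≡_)
  open import Relation.Binary.Structures using (IsEquivalence)
  open Congruence
  open RingFromLaws

  -- Elements c₀ + c₁ ζ + ... + c₆ ζ⁶ of the group ring ℤ[ζ]/(ζ⁷ - 1).
  record C7 : Set where
    constructor c7
    field
      co0 co1 co2 co3 co4 co5 co6 : ℤ
  open C7 public

  record Pointwise (_∼_ : ℤ → ℤ → Set) (x y : C7) : Set where
    constructor pw
    field
      r0 : co0 x ∼ co0 y
      r1 : co1 x ∼ co1 y
      r2 : co2 x ∼ co2 y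
      r3 : co3 x ∼ co3 y
      r4 : co4 x ∼ co4 y
      r5 : co5 x ∼ co5 y
      r6 : co6 x ∼ co6 y
  open Pointwise public

  -- Multiplication is a cyclic convolution: the k-th coefficient of x y is the dot
  -- product of x with the coefficients of y read backwards from position k.
  dot : C7 → C7 → ℤ
  dot (c7 a0 a1 a2 a3 a4 a5 a6) (c7 b0 b1 b2 b3 b4 b5 b6) =
    a0 * b0 + a1 * b1 + a2 * b2 + a3 * b3 + a4 * b4 + a5 * b5 + a6 * b6

  backwards : C7 → C7
  backwards (c7 b0 b1 b2 b3 b4 b5 b6) = c7 b0 b6 b5 b4 b3 b2 b1

  rotate : C7 → C7
  rotate (c7 b0 b1 b2 b3 b4 b5 b6) = c7 b6 b0 b1 b2 b3 b4 b5

  infixl 6 _⊕_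
  infixl 7 _⊗_
  infix 8 ⊖_
  _⊕_ : C7 → C7 → C7
  c7 a0 a1 a2 a3 a4 a5 a6 ⊕ c7 b0 b1 b2 b3 b4 b5 b6 =
    c7 (a0 + b0) (a1 + b1) (a2 + b2) (a3 + b3) (a4 + b4) (a5 + b5) (a6 + b6)

  _⊗_ : C7 → C7 → C7
  x ⊗ y = c7 (dot x y₀) (dot x y₁) (dot x y₂) (dot x y₃) (dot x y₄) (dot x y₅) (dot x y₆)
    where
      y₀ = backwards y
      y₁ = rotate y₀
      y₂ = rotate y₁
      y₃ = rotate y₂
      y₄ = rotate y₃
      y₅ = rotate y₄
      y₆ = rotate y₅

  ⊖_ : C7 → C7
  ⊖ c7 a0 a1 a2 a3 a4 a5 a6 = c7 (- a0) (- a1) (- a2) (- a3) (- a4) (- a5) (- a6)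

  𝟘 𝟙 : C7
  𝟘 = c7 (+ 0) (+ 0) (+ 0) (+ 0) (+ 0) (+ 0) (+ 0)
  𝟙 = c7 (+ 1) (+ 0) (+ 0) (+ 0) (+ 0) (+ 0) (+ 0)

  c7≡ : ∀ {a0 a1 a2 a3 a4 a5 a6 b0 b1 b2 b3 b4 b5 b6} →
        a0 ≡ b0 → a1 ≡ b1 → a2 ≡ b2 → a3 ≡ b3 → a4 ≡ b4 → a5 ≡ b5 → a6 ≡ b6 →
        c7 a0 a1 a2 a3 a4 a5 a6 ≡ c7 b0 b1 b2 b3 b4 b5 b6
  c7≡ ≡.refl ≡.refl ≡.refl ≡.refl ≡.refl ≡.refl ≡.refl = ≡.refl

  private
    ⊗-assoc₀ : ∀ (a0 a1 a2 a3 a4 a5 a6 b0 b1 b2 b3 b4 b5 b6 c0 c1 c2 c3 c4 c5 c6 : ℤ) →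
        (a0 * b0 + a1 * b6 + a2 * b5 + a3 * b4 + a4 * b3 + a5 * b2 + a6 * b1) * c0
        + (a0 * b1 + a1 * b0 + a2 * b6 + a3 * b5 + a4 * b4 + a5 * b3 + a6 * b2) * c6
        + (a0 * b2 + a1 * b1 + a2 * b0 + a3 * b6 + a4 * b5 + a5 * b4 + a6 * b3) * c5
        + (a0 * b3 + a1 * b2 + a2 * b1 + a3 * b0 + a4 * b6 + a5 * b5 + a6 * b4) * c4
        + (a0 * b4 + a1 * b3 + a2 * b2 + a3 * b1 + a4 * b0 + a5 * b6 + a6 * b5) * c3
        + (a0 * b5 + a1 * b4 + a2 * b3 + a3 * b2 + a4 * b1 + a5 * b0 + a6 * b6) * c2
        + (a0 * b6 + a1 * b5 + a2 * b4 + a3 * b3 + a4 * b2 + a5 * b1 + a6 * b0) * c1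
      ≡
        a0 * (b0 * c0 + b1 * c6 + b2 * c5 + b3 * c4 + b4 * c3 + b5 * c2 + b6 * c1)
        + a1 * (b0 * c6 + b1 * c5 + b2 * c4 + b3 * c3 + b4 * c2 + b5 * c1 + b6 * c0)
        + a2 * (b0 * c5 + b1 * c4 + b2 * c3 + b3 * c2 + b4 * c1 + b5 * c0 + b6 * c6)
        + a3 * (b0 * c4 + b1 * c3 + b2 * c2 + b3 * c1 + b4 * c0 + b5 * c6 + b6 * c5)
        + a4 * (b0 * c3 + b1 * c2 + b2 * c1 + b3 * c0 + b4 * c6 + b5 * c5 + b6 * c4)
        + a5 * (b0 * c2 + b1 * c1 + b2 * c0 + b3 * c6 + b4 * c5 + b5 * c4 + b6 * c3)
        + a6 * (b0 * c1 + b1 * c0 + b2 * c6 + b3 * c5 + b4 * c4 + b5 * c3 + b6 * c2)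
    ⊗-assoc₀ = solve-∀
    ⊗-assoc₁ : ∀ (a0 a1 a2 a3 a4 a5 a6 b0 b1 b2 b3 b4 b5 b6 c0 c1 c2 c3 c4 c5 c6 : ℤ) →
        (a0 * b0 + a1 * b6 + a2 * b5 + a3 * b4 + a4 * b3 + a5 * b2 + a6 * b1) * c1
        + (a0 * b1 + a1 * b0 + a2 * b6 + a3 * b5 + a4 * b4 + a5 * b3 + a6 * b2) * c0
        + (a0 * b2 + a1 * b1 + a2 * b0 + a3 * b6 + a4 * b5 + a5 * b4 + a6 * b3) * c6
        + (a0 * b3 + a1 * b2 + a2 * b1 + a3 * b0 + a4 * b6 + a5 * b5 + a6 * b4) * c5
        + (a0 * b4 + a1 * b3 + a2 * b2 + a3 * b1 + a4 * b0 + a5 * b6 + a6 * b5) * c4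
        + (a0 * b5 + a1 * b4 + a2 * b3 + a3 * b2 + a4 * b1 + a5 * b0 + a6 * b6) * c3
        + (a0 * b6 + a1 * b5 + a2 * b4 + a3 * b3 + a4 * b2 + a5 * b1 + a6 * b0) * c2
      ≡
        a0 * (b0 * c1 + b1 * c0 + b2 * c6 + b3 * c5 + b4 * c4 + b5 * c3 + b6 * c2)
        + a1 * (b0 * c0 + b1 * c6 + b2 * c5 + b3 * c4 + b4 * c3 + b5 * c2 + b6 * c1)
        + a2 * (b0 * c6 + b1 * c5 + b2 * c4 + b3 * c3 + b4 * c2 + b5 * c1 + b6 * c0)
        + a3 * (b0 * c5 + b1 * c4 + b2 * c3 + b3 * c2 + b4 * c1 + b5 * c0 + b6 * c6)
        + a4 * (b0 * c4 + b1 * c3 + b2 * c2 + b3 * c1 + b4 * c0 + b5 * c6 + b6 * c5)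
        + a5 * (b0 * c3 + b1 * c2 + b2 * c1 + b3 * c0 + b4 * c6 + b5 * c5 + b6 * c4)
        + a6 * (b0 * c2 + b1 * c1 + b2 * c0 + b3 * c6 + b4 * c5 + b5 * c4 + b6 * c3)
    ⊗-assoc₁ = solve-∀
    ⊗-assoc₂ : ∀ (a0 a1 a2 a3 a4 a5 a6 b0 b1 b2 b3 b4 b5 b6 c0 c1 c2 c3 c4 c5 c6 : ℤ) →
        (a0 * b0 + a1 * b6 + a2 * b5 + a3 * b4 + a4 * b3 + a5 * b2 + a6 * b1) * c2
        + (a0 * b1 + a1 * b0 + a2 * b6 + a3 * b5 + a4 * b4 + a5 * b3 + a6 * b2) * c1
        + (a0 * b2 + a1 * b1 + a2 * b0 + a3 * b6 + a4 * b5 + a5 * b4 + a6 * b3) * c0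
        + (a0 * b3 + a1 * b2 + a2 * b1 + a3 * b0 + a4 * b6 + a5 * b5 + a6 * b4) * c6
        + (a0 * b4 + a1 * b3 + a2 * b2 + a3 * b1 + a4 * b0 + a5 * b6 + a6 * b5) * c5
        + (a0 * b5 + a1 * b4 + a2 * b3 + a3 * b2 + a4 * b1 + a5 * b0 + a6 * b6) * c4
        + (a0 * b6 + a1 * b5 + a2 * b4 + a3 * b3 + a4 * b2 + a5 * b1 + a6 * b0) * c3
      ≡
        a0 * (b0 * c2 + b1 * c1 + b2 * c0 + b3 * c6 + b4 * c5 + b5 * c4 + b6 * c3)
        + a1 * (b0 * c1 + b1 * c0 + b2 * c6 + b3 * c5 + b4 * c4 + b5 * c3 + b6 * c2)
        + a2 * (b0 * c0 + b1 * c6 + b2 * c5 + b3 * c4 + b4 * c3 + b5 * c2 + b6 * c1)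
        + a3 * (b0 * c6 + b1 * c5 + b2 * c4 + b3 * c3 + b4 * c2 + b5 * c1 + b6 * c0)
        + a4 * (b0 * c5 + b1 * c4 + b2 * c3 + b3 * c2 + b4 * c1 + b5 * c0 + b6 * c6)
        + a5 * (b0 * c4 + b1 * c3 + b2 * c2 + b3 * c1 + b4 * c0 + b5 * c6 + b6 * c5)
        + a6 * (b0 * c3 + b1 * c2 + b2 * c1 + b3 * c0 + b4 * c6 + b5 * c5 + b6 * c4)
    ⊗-assoc₂ = solve-∀
    ⊗-assoc₃ : ∀ (a0 a1 a2 a3 a4 a5 a6 b0 b1 b2 b3 b4 b5 b6 c0 c1 c2 c3 c4 c5 c6 : ℤ) →
        (a0 * b0 + a1 * b6 + a2 * b5 + a3 * b4 + a4 * b3 + a5 * b2 + a6 * b1) * c3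
        + (a0 * b1 + a1 * b0 + a2 * b6 + a3 * b5 + a4 * b4 + a5 * b3 + a6 * b2) * c2
        + (a0 * b2 + a1 * b1 + a2 * b0 + a3 * b6 + a4 * b5 + a5 * b4 + a6 * b3) * c1
        + (a0 * b3 + a1 * b2 + a2 * b1 + a3 * b0 + a4 * b6 + a5 * b5 + a6 * b4) * c0
        + (a0 * b4 + a1 * b3 + a2 * b2 + a3 * b1 + a4 * b0 + a5 * b6 + a6 * b5) * c6
        + (a0 * b5 + a1 * b4 + a2 * b3 + a3 * b2 + a4 * b1 + a5 * b0 + a6 * b6) * c5
        + (a0 * b6 + a1 * b5 + a2 * b4 + a3 * b3 + a4 * b2 + a5 * b1 + a6 * b0) * c4
      ≡
        a0 * (b0 * c3 + b1 * c2 + b2 * c1 + b3 * c0 + b4 * c6 + b5 * c5 + b6 * c4)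
        + a1 * (b0 * c2 + b1 * c1 + b2 * c0 + b3 * c6 + b4 * c5 + b5 * c4 + b6 * c3)
        + a2 * (b0 * c1 + b1 * c0 + b2 * c6 + b3 * c5 + b4 * c4 + b5 * c3 + b6 * c2)
        + a3 * (b0 * c0 + b1 * c6 + b2 * c5 + b3 * c4 + b4 * c3 + b5 * c2 + b6 * c1)
        + a4 * (b0 * c6 + b1 * c5 + b2 * c4 + b3 * c3 + b4 * c2 + b5 * c1 + b6 * c0)
        + a5 * (b0 * c5 + b1 * c4 + b2 * c3 + b3 * c2 + b4 * c1 + b5 * c0 + b6 * c6)
        + a6 * (b0 * c4 + b1 * c3 + b2 * c2 + b3 * c1 + b4 * c0 + b5 * c6 + b6 * c5)
    ⊗-assoc₃ = solve-∀
    ⊗-assoc₄ : ∀ (a0 a1 a2 a3 a4 a5 a6 b0 b1 b2 b3 b4 b5 b6 c0 c1 c2 c3 c4 c5 c6 : ℤ) →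
        (a0 * b0 + a1 * b6 + a2 * b5 + a3 * b4 + a4 * b3 + a5 * b2 + a6 * b1) * c4
        + (a0 * b1 + a1 * b0 + a2 * b6 + a3 * b5 + a4 * b4 + a5 * b3 + a6 * b2) * c3
        + (a0 * b2 + a1 * b1 + a2 * b0 + a3 * b6 + a4 * b5 + a5 * b4 + a6 * b3) * c2
        + (a0 * b3 + a1 * b2 + a2 * b1 + a3 * b0 + a4 * b6 + a5 * b5 + a6 * b4) * c1
        + (a0 * b4 + a1 * b3 + a2 * b2 + a3 * b1 + a4 * b0 + a5 * b6 + a6 * b5) * c0
        + (a0 * b5 + a1 * b4 + a2 * b3 + a3 * b2 + a4 * b1 + a5 * b0 + a6 * b6) * c6
        + (a0 * b6 + a1 * b5 + a2 * b4 + a3 * b3 + a4 * b2 + a5 * b1 + a6 * b0) * c5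
      ≡
        a0 * (b0 * c4 + b1 * c3 + b2 * c2 + b3 * c1 + b4 * c0 + b5 * c6 + b6 * c5)
        + a1 * (b0 * c3 + b1 * c2 + b2 * c1 + b3 * c0 + b4 * c6 + b5 * c5 + b6 * c4)
        + a2 * (b0 * c2 + b1 * c1 + b2 * c0 + b3 * c6 + b4 * c5 + b5 * c4 + b6 * c3)
        + a3 * (b0 * c1 + b1 * c0 + b2 * c6 + b3 * c5 + b4 * c4 + b5 * c3 + b6 * c2)
        + a4 * (b0 * c0 + b1 * c6 + b2 * c5 + b3 * c4 + b4 * c3 + b5 * c2 + b6 * c1)
        + a5 * (b0 * c6 + b1 * c5 + b2 * c4 + b3 * c3 + b4 * c2 + b5 * c1 + b6 * c0)
        + a6 * (b0 * c5 + b1 * c4 + b2 * c3 + b3 * c2 + b4 * c1 + b5 * c0 + b6 * c6)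
    ⊗-assoc₄ = solve-∀
    ⊗-assoc₅ : ∀ (a0 a1 a2 a3 a4 a5 a6 b0 b1 b2 b3 b4 b5 b6 c0 c1 c2 c3 c4 c5 c6 : ℤ) →
        (a0 * b0 + a1 * b6 + a2 * b5 + a3 * b4 + a4 * b3 + a5 * b2 + a6 * b1) * c5
        + (a0 * b1 + a1 * b0 + a2 * b6 + a3 * b5 + a4 * b4 + a5 * b3 + a6 * b2) * c4
        + (a0 * b2 + a1 * b1 + a2 * b0 + a3 * b6 + a4 * b5 + a5 * b4 + a6 * b3) * c3
        + (a0 * b3 + a1 * b2 + a2 * b1 + a3 * b0 + a4 * b6 + a5 * b5 + a6 * b4) * c2
        + (a0 * b4 + a1 * b3 + a2 * b2 + a3 * b1 + a4 * b0 + a5 * b6 + a6 * b5) * c1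
        + (a0 * b5 + a1 * b4 + a2 * b3 + a3 * b2 + a4 * b1 + a5 * b0 + a6 * b6) * c0
        + (a0 * b6 + a1 * b5 + a2 * b4 + a3 * b3 + a4 * b2 + a5 * b1 + a6 * b0) * c6
      ≡
        a0 * (b0 * c5 + b1 * c4 + b2 * c3 + b3 * c2 + b4 * c1 + b5 * c0 + b6 * c6)
        + a1 * (b0 * c4 + b1 * c3 + b2 * c2 + b3 * c1 + b4 * c0 + b5 * c6 + b6 * c5)
        + a2 * (b0 * c3 + b1 * c2 + b2 * c1 + b3 * c0 + b4 * c6 + b5 * c5 + b6 * c4)
        + a3 * (b0 * c2 + b1 * c1 + b2 * c0 + b3 * c6 + b4 * c5 + b5 * c4 + b6 * c3)
        + a4 * (b0 * c1 + b1 * c0 + b2 * c6 + b3 * c5 + b4 * c4 + b5 * c3 + b6 * c2)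
        + a5 * (b0 * c0 + b1 * c6 + b2 * c5 + b3 * c4 + b4 * c3 + b5 * c2 + b6 * c1)
        + a6 * (b0 * c6 + b1 * c5 + b2 * c4 + b3 * c3 + b4 * c2 + b5 * c1 + b6 * c0)
    ⊗-assoc₅ = solve-∀
    ⊗-assoc₆ : ∀ (a0 a1 a2 a3 a4 a5 a6 b0 b1 b2 b3 b4 b5 b6 c0 c1 c2 c3 c4 c5 c6 : ℤ) →
        (a0 * b0 + a1 * b6 + a2 * b5 + a3 * b4 + a4 * b3 + a5 * b2 + a6 * b1) * c6
        + (a0 * b1 + a1 * b0 + a2 * b6 + a3 * b5 + a4 * b4 + a5 * b3 + a6 * b2) * c5
        + (a0 * b2 + a1 * b1 + a2 * b0 + a3 * b6 + a4 * b5 + a5 * b4 + a6 * b3) * c4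
        + (a0 * b3 + a1 * b2 + a2 * b1 + a3 * b0 + a4 * b6 + a5 * b5 + a6 * b4) * c3
        + (a0 * b4 + a1 * b3 + a2 * b2 + a3 * b1 + a4 * b0 + a5 * b6 + a6 * b5) * c2
        + (a0 * b5 + a1 * b4 + a2 * b3 + a3 * b2 + a4 * b1 + a5 * b0 + a6 * b6) * c1
        + (a0 * b6 + a1 * b5 + a2 * b4 + a3 * b3 + a4 * b2 + a5 * b1 + a6 * b0) * c0
      ≡
        a0 * (b0 * c6 + b1 * c5 + b2 * c4 + b3 * c3 + b4 * c2 + b5 * c1 + b6 * c0)
        + a1 * (b0 * c5 + b1 * c4 + b2 * c3 + b3 * c2 + b4 * c1 + b5 * c0 + b6 * c6)
        + a2 * (b0 * c4 + b1 * c3 + b2 * c2 + b3 * c1 + b4 * c0 + b5 * c6 + b6 * c5)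
        + a3 * (b0 * c3 + b1 * c2 + b2 * c1 + b3 * c0 + b4 * c6 + b5 * c5 + b6 * c4)
        + a4 * (b0 * c2 + b1 * c1 + b2 * c0 + b3 * c6 + b4 * c5 + b5 * c4 + b6 * c3)
        + a5 * (b0 * c1 + b1 * c0 + b2 * c6 + b3 * c5 + b4 * c4 + b5 * c3 + b6 * c2)
        + a6 * (b0 * c0 + b1 * c6 + b2 * c5 + b3 * c4 + b4 * c3 + b5 * c2 + b6 * c1)
    ⊗-assoc₆ = solve-∀
    ⊗-comm₀ : ∀ (a0 a1 a2 a3 a4 a5 a6 b0 b1 b2 b3 b4 b5 b6 : ℤ) →
        a0 * b0 + a1 * b6 + a2 * b5 + a3 * b4 + a4 * b3 + a5 * b2 + a6 * b1
      ≡
        b0 * a0 + b1 * a6 + b2 * a5 + b3 * a4 + b4 * a3 + b5 * a2 + b6 * a1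
    ⊗-comm₀ = solve-∀
    ⊗-comm₁ : ∀ (a0 a1 a2 a3 a4 a5 a6 b0 b1 b2 b3 b4 b5 b6 : ℤ) →
        a0 * b1 + a1 * b0 + a2 * b6 + a3 * b5 + a4 * b4 + a5 * b3 + a6 * b2
      ≡
        b0 * a1 + b1 * a0 + b2 * a6 + b3 * a5 + b4 * a4 + b5 * a3 + b6 * a2
    ⊗-comm₁ = solve-∀
    ⊗-comm₂ : ∀ (a0 a1 a2 a3 a4 a5 a6 b0 b1 b2 b3 b4 b5 b6 : ℤ) →
        a0 * b2 + a1 * b1 + a2 * b0 + a3 * b6 + a4 * b5 + a5 * b4 + a6 * b3
      ≡
        b0 * a2 + b1 * a1 + b2 * a0 + b3 * a6 + b4 * a5 + b5 * a4 + b6 * a3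
    ⊗-comm₂ = solve-∀
    ⊗-comm₃ : ∀ (a0 a1 a2 a3 a4 a5 a6 b0 b1 b2 b3 b4 b5 b6 : ℤ) →
        a0 * b3 + a1 * b2 + a2 * b1 + a3 * b0 + a4 * b6 + a5 * b5 + a6 * b4
      ≡
        b0 * a3 + b1 * a2 + b2 * a1 + b3 * a0 + b4 * a6 + b5 * a5 + b6 * a4
    ⊗-comm₃ = solve-∀
    ⊗-comm₄ : ∀ (a0 a1 a2 a3 a4 a5 a6 b0 b1 b2 b3 b4 b5 b6 : ℤ) →
        a0 * b4 + a1 * b3 + a2 * b2 + a3 * b1 + a4 * b0 + a5 * b6 + a6 * b5
      ≡
        b0 * a4 + b1 * a3 + b2 * a2 + b3 * a1 + b4 * a0 + b5 * a6 + b6 * a5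
    ⊗-comm₄ = solve-∀
    ⊗-comm₅ : ∀ (a0 a1 a2 a3 a4 a5 a6 b0 b1 b2 b3 b4 b5 b6 : ℤ) →
        a0 * b5 + a1 * b4 + a2 * b3 + a3 * b2 + a4 * b1 + a5 * b0 + a6 * b6
      ≡
        b0 * a5 + b1 * a4 + b2 * a3 + b3 * a2 + b4 * a1 + b5 * a0 + b6 * a6
    ⊗-comm₅ = solve-∀
    ⊗-comm₆ : ∀ (a0 a1 a2 a3 a4 a5 a6 b0 b1 b2 b3 b4 b5 b6 : ℤ) →
        a0 * b6 + a1 * b5 + a2 * b4 + a3 * b3 + a4 * b2 + a5 * b1 + a6 * b0
      ≡
        b0 * a6 + b1 * a5 + b2 * a4 + b3 * a3 + b4 * a2 + b5 * a1 + b6 * a0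
    ⊗-comm₆ = solve-∀
    ⊗-identityˡ₀ : ∀ (a0 a1 a2 a3 a4 a5 a6 : ℤ) →
        + 1 * a0 + + 0 * a6 + + 0 * a5 + + 0 * a4 + + 0 * a3 + + 0 * a2 + + 0 * a1
      ≡
        a0
    ⊗-identityˡ₀ = solve-∀
    ⊗-identityʳ₀ : ∀ (a0 a1 a2 a3 a4 a5 a6 : ℤ) →
        a0 * + 1 + a1 * + 0 + a2 * + 0 + a3 * + 0 + a4 * + 0 + a5 * + 0 + a6 * + 0
      ≡
        a0
    ⊗-identityʳ₀ = solve-∀
    ⊗-identityˡ₁ : ∀ (a0 a1 a2 a3 a4 a5 a6 : ℤ) →
        + 1 * a1 + + 0 * a0 + + 0 * a6 + + 0 * a5 + + 0 * a4 + + 0 * a3 + + 0 * a2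
      ≡
        a1
    ⊗-identityˡ₁ = solve-∀
    ⊗-identityʳ₁ : ∀ (a0 a1 a2 a3 a4 a5 a6 : ℤ) →
        a0 * + 0 + a1 * + 1 + a2 * + 0 + a3 * + 0 + a4 * + 0 + a5 * + 0 + a6 * + 0
      ≡
        a1
    ⊗-identityʳ₁ = solve-∀
    ⊗-identityˡ₂ : ∀ (a0 a1 a2 a3 a4 a5 a6 : ℤ) →
        + 1 * a2 + + 0 * a1 + + 0 * a0 + + 0 * a6 + + 0 * a5 + + 0 * a4 + + 0 * a3
      ≡
        a2
    ⊗-identityˡ₂ = solve-∀
    ⊗-identityʳ₂ : ∀ (a0 a1 a2 a3 a4 a5 a6 : ℤ) →
        a0 * + 0 + a1 * + 0 + a2 * + 1 + a3 * + 0 + a4 * + 0 + a5 * + 0 + a6 * + 0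
      ≡
        a2
    ⊗-identityʳ₂ = solve-∀
    ⊗-identityˡ₃ : ∀ (a0 a1 a2 a3 a4 a5 a6 : ℤ) →
        + 1 * a3 + + 0 * a2 + + 0 * a1 + + 0 * a0 + + 0 * a6 + + 0 * a5 + + 0 * a4
      ≡
        a3
    ⊗-identityˡ₃ = solve-∀
    ⊗-identityʳ₃ : ∀ (a0 a1 a2 a3 a4 a5 a6 : ℤ) →
        a0 * + 0 + a1 * + 0 + a2 * + 0 + a3 * + 1 + a4 * + 0 + a5 * + 0 + a6 * + 0
      ≡
        a3
    ⊗-identityʳ₃ = solve-∀
    ⊗-identityˡ₄ : ∀ (a0 a1 a2 a3 a4 a5 a6 : ℤ) →
        + 1 * a4 + + 0 * a3 + + 0 * a2 + + 0 * a1 + + 0 * a0 + + 0 * a6 + + 0 * a5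
      ≡
        a4
    ⊗-identityˡ₄ = solve-∀
    ⊗-identityʳ₄ : ∀ (a0 a1 a2 a3 a4 a5 a6 : ℤ) →
        a0 * + 0 + a1 * + 0 + a2 * + 0 + a3 * + 0 + a4 * + 1 + a5 * + 0 + a6 * + 0
      ≡
        a4
    ⊗-identityʳ₄ = solve-∀
    ⊗-identityˡ₅ : ∀ (a0 a1 a2 a3 a4 a5 a6 : ℤ) →
        + 1 * a5 + + 0 * a4 + + 0 * a3 + + 0 * a2 + + 0 * a1 + + 0 * a0 + + 0 * a6
      ≡
        a5
    ⊗-identityˡ₅ = solve-∀
    ⊗-identityʳ₅ : ∀ (a0 a1 a2 a3 a4 a5 a6 : ℤ) →
        a0 * + 0 + a1 * + 0 + a2 * + 0 + a3 * + 0 + a4 * + 0 + a5 * + 1 + a6 * + 0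
      ≡
        a5
    ⊗-identityʳ₅ = solve-∀
    ⊗-identityˡ₆ : ∀ (a0 a1 a2 a3 a4 a5 a6 : ℤ) →
        + 1 * a6 + + 0 * a5 + + 0 * a4 + + 0 * a3 + + 0 * a2 + + 0 * a1 + + 0 * a0
      ≡
        a6
    ⊗-identityˡ₆ = solve-∀
    ⊗-identityʳ₆ : ∀ (a0 a1 a2 a3 a4 a5 a6 : ℤ) →
        a0 * + 0 + a1 * + 0 + a2 * + 0 + a3 * + 0 + a4 * + 0 + a5 * + 0 + a6 * + 1
      ≡
        a6
    ⊗-identityʳ₆ = solve-∀
    distribˡ₀ : ∀ (a0 a1 a2 a3 a4 a5 a6 b0 b1 b2 b3 b4 b5 b6 c0 c1 c2 c3 c4 c5 c6 : ℤ) →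
        a0 * (b0 + c0) + a1 * (b6 + c6) + a2 * (b5 + c5) + a3 * (b4 + c4) + a4 * (b3 + c3)
        + a5 * (b2 + c2) + a6 * (b1 + c1)
      ≡
        (a0 * b0 + a1 * b6 + a2 * b5 + a3 * b4 + a4 * b3 + a5 * b2 + a6 * b1)
        + (a0 * c0 + a1 * c6 + a2 * c5 + a3 * c4 + a4 * c3 + a5 * c2 + a6 * c1)
    distribˡ₀ = solve-∀
    distribˡ₁ : ∀ (a0 a1 a2 a3 a4 a5 a6 b0 b1 b2 b3 b4 b5 b6 c0 c1 c2 c3 c4 c5 c6 : ℤ) →
        a0 * (b1 + c1) + a1 * (b0 + c0) + a2 * (b6 + c6) + a3 * (b5 + c5) + a4 * (b4 + c4)
        + a5 * (b3 + c3) + a6 * (b2 + c2)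
      ≡
        (a0 * b1 + a1 * b0 + a2 * b6 + a3 * b5 + a4 * b4 + a5 * b3 + a6 * b2)
        + (a0 * c1 + a1 * c0 + a2 * c6 + a3 * c5 + a4 * c4 + a5 * c3 + a6 * c2)
    distribˡ₁ = solve-∀
    distribˡ₂ : ∀ (a0 a1 a2 a3 a4 a5 a6 b0 b1 b2 b3 b4 b5 b6 c0 c1 c2 c3 c4 c5 c6 : ℤ) →
        a0 * (b2 + c2) + a1 * (b1 + c1) + a2 * (b0 + c0) + a3 * (b6 + c6) + a4 * (b5 + c5)
        + a5 * (b4 + c4) + a6 * (b3 + c3)
      ≡
        (a0 * b2 + a1 * b1 + a2 * b0 + a3 * b6 + a4 * b5 + a5 * b4 + a6 * b3)
        + (a0 * c2 + a1 * c1 + a2 * c0 + a3 * c6 + a4 * c5 + a5 * c4 + a6 * c3)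
    distribˡ₂ = solve-∀
    distribˡ₃ : ∀ (a0 a1 a2 a3 a4 a5 a6 b0 b1 b2 b3 b4 b5 b6 c0 c1 c2 c3 c4 c5 c6 : ℤ) →
        a0 * (b3 + c3) + a1 * (b2 + c2) + a2 * (b1 + c1) + a3 * (b0 + c0) + a4 * (b6 + c6)
        + a5 * (b5 + c5) + a6 * (b4 + c4)
      ≡
        (a0 * b3 + a1 * b2 + a2 * b1 + a3 * b0 + a4 * b6 + a5 * b5 + a6 * b4)
        + (a0 * c3 + a1 * c2 + a2 * c1 + a3 * c0 + a4 * c6 + a5 * c5 + a6 * c4)
    distribˡ₃ = solve-∀
    distribˡ₄ : ∀ (a0 a1 a2 a3 a4 a5 a6 b0 b1 b2 b3 b4 b5 b6 c0 c1 c2 c3 c4 c5 c6 : ℤ) →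
        a0 * (b4 + c4) + a1 * (b3 + c3) + a2 * (b2 + c2) + a3 * (b1 + c1) + a4 * (b0 + c0)
        + a5 * (b6 + c6) + a6 * (b5 + c5)
      ≡
        (a0 * b4 + a1 * b3 + a2 * b2 + a3 * b1 + a4 * b0 + a5 * b6 + a6 * b5)
        + (a0 * c4 + a1 * c3 + a2 * c2 + a3 * c1 + a4 * c0 + a5 * c6 + a6 * c5)
    distribˡ₄ = solve-∀
    distribˡ₅ : ∀ (a0 a1 a2 a3 a4 a5 a6 b0 b1 b2 b3 b4 b5 b6 c0 c1 c2 c3 c4 c5 c6 : ℤ) →
        a0 * (b5 + c5) + a1 * (b4 + c4) + a2 * (b3 + c3) + a3 * (b2 + c2) + a4 * (b1 + c1)
        + a5 * (b0 + c0) + a6 * (b6 + c6)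
      ≡
        (a0 * b5 + a1 * b4 + a2 * b3 + a3 * b2 + a4 * b1 + a5 * b0 + a6 * b6)
        + (a0 * c5 + a1 * c4 + a2 * c3 + a3 * c2 + a4 * c1 + a5 * c0 + a6 * c6)
    distribˡ₅ = solve-∀
    distribˡ₆ : ∀ (a0 a1 a2 a3 a4 a5 a6 b0 b1 b2 b3 b4 b5 b6 c0 c1 c2 c3 c4 c5 c6 : ℤ) →
        a0 * (b6 + c6) + a1 * (b5 + c5) + a2 * (b4 + c4) + a3 * (b3 + c3) + a4 * (b2 + c2)
        + a5 * (b1 + c1) + a6 * (b0 + c0)
      ≡
        (a0 * b6 + a1 * b5 + a2 * b4 + a3 * b3 + a4 * b2 + a5 * b1 + a6 * b0)
        + (a0 * c6 + a1 * c5 + a2 * c4 + a3 * c3 + a4 * c2 + a5 * c1 + a6 * c0)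
    distribˡ₆ = solve-∀
    distribʳ₀ : ∀ (a0 a1 a2 a3 a4 a5 a6 b0 b1 b2 b3 b4 b5 b6 c0 c1 c2 c3 c4 c5 c6 : ℤ) →
        (b0 + c0) * a0 + (b1 + c1) * a6 + (b2 + c2) * a5 + (b3 + c3) * a4 + (b4 + c4) * a3
        + (b5 + c5) * a2 + (b6 + c6) * a1
      ≡
        (b0 * a0 + b1 * a6 + b2 * a5 + b3 * a4 + b4 * a3 + b5 * a2 + b6 * a1)
        + (c0 * a0 + c1 * a6 + c2 * a5 + c3 * a4 + c4 * a3 + c5 * a2 + c6 * a1)
    distribʳ₀ = solve-∀
    distribʳ₁ : ∀ (a0 a1 a2 a3 a4 a5 a6 b0 b1 b2 b3 b4 b5 b6 c0 c1 c2 c3 c4 c5 c6 : ℤ) →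
        (b0 + c0) * a1 + (b1 + c1) * a0 + (b2 + c2) * a6 + (b3 + c3) * a5 + (b4 + c4) * a4
        + (b5 + c5) * a3 + (b6 + c6) * a2
      ≡
        (b0 * a1 + b1 * a0 + b2 * a6 + b3 * a5 + b4 * a4 + b5 * a3 + b6 * a2)
        + (c0 * a1 + c1 * a0 + c2 * a6 + c3 * a5 + c4 * a4 + c5 * a3 + c6 * a2)
    distribʳ₁ = solve-∀
    distribʳ₂ : ∀ (a0 a1 a2 a3 a4 a5 a6 b0 b1 b2 b3 b4 b5 b6 c0 c1 c2 c3 c4 c5 c6 : ℤ) →
        (b0 + c0) * a2 + (b1 + c1) * a1 + (b2 + c2) * a0 + (b3 + c3) * a6 + (b4 + c4) * a5
        + (b5 + c5) * a4 + (b6 + c6) * a3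
      ≡
        (b0 * a2 + b1 * a1 + b2 * a0 + b3 * a6 + b4 * a5 + b5 * a4 + b6 * a3)
        + (c0 * a2 + c1 * a1 + c2 * a0 + c3 * a6 + c4 * a5 + c5 * a4 + c6 * a3)
    distribʳ₂ = solve-∀
    distribʳ₃ : ∀ (a0 a1 a2 a3 a4 a5 a6 b0 b1 b2 b3 b4 b5 b6 c0 c1 c2 c3 c4 c5 c6 : ℤ) →
        (b0 + c0) * a3 + (b1 + c1) * a2 + (b2 + c2) * a1 + (b3 + c3) * a0 + (b4 + c4) * a6
        + (b5 + c5) * a5 + (b6 + c6) * a4
      ≡
        (b0 * a3 + b1 * a2 + b2 * a1 + b3 * a0 + b4 * a6 + b5 * a5 + b6 * a4)
        + (c0 * a3 + c1 * a2 + c2 * a1 + c3 * a0 + c4 * a6 + c5 * a5 + c6 * a4)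
    distribʳ₃ = solve-∀
    distribʳ₄ : ∀ (a0 a1 a2 a3 a4 a5 a6 b0 b1 b2 b3 b4 b5 b6 c0 c1 c2 c3 c4 c5 c6 : ℤ) →
        (b0 + c0) * a4 + (b1 + c1) * a3 + (b2 + c2) * a2 + (b3 + c3) * a1 + (b4 + c4) * a0
        + (b5 + c5) * a6 + (b6 + c6) * a5
      ≡
        (b0 * a4 + b1 * a3 + b2 * a2 + b3 * a1 + b4 * a0 + b5 * a6 + b6 * a5)
        + (c0 * a4 + c1 * a3 + c2 * a2 + c3 * a1 + c4 * a0 + c5 * a6 + c6 * a5)
    distribʳ₄ = solve-∀
    distribʳ₅ : ∀ (a0 a1 a2 a3 a4 a5 a6 b0 b1 b2 b3 b4 b5 b6 c0 c1 c2 c3 c4 c5 c6 : ℤ) →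
        (b0 + c0) * a5 + (b1 + c1) * a4 + (b2 + c2) * a3 + (b3 + c3) * a2 + (b4 + c4) * a1
        + (b5 + c5) * a0 + (b6 + c6) * a6
      ≡
        (b0 * a5 + b1 * a4 + b2 * a3 + b3 * a2 + b4 * a1 + b5 * a0 + b6 * a6)
        + (c0 * a5 + c1 * a4 + c2 * a3 + c3 * a2 + c4 * a1 + c5 * a0 + c6 * a6)
    distribʳ₅ = solve-∀
    distribʳ₆ : ∀ (a0 a1 a2 a3 a4 a5 a6 b0 b1 b2 b3 b4 b5 b6 c0 c1 c2 c3 c4 c5 c6 : ℤ) →
        (b0 + c0) * a6 + (b1 + c1) * a5 + (b2 + c2) * a4 + (b3 + c3) * a3 + (b4 + c4) * a2
        + (b5 + c5) * a1 + (b6 + c6) * a0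
      ≡
        (b0 * a6 + b1 * a5 + b2 * a4 + b3 * a3 + b4 * a2 + b5 * a1 + b6 * a0)
        + (c0 * a6 + c1 * a5 + c2 * a4 + c3 * a3 + c4 * a2 + c5 * a1 + c6 * a0)
    distribʳ₆ = solve-∀

  module CyclotomicRing (n : ℕ) where

    infix 4 _≈_
    _≈_ : C7 → C7 → Set
    _≈_ = Pointwise _≡[ n ]_

    ≈-isEquivalence : IsEquivalence _≈_
    ≈-isEquivalence = record
      { refl = pw ≡ₙ-refl ≡ₙ-refl ≡ₙ-refl ≡ₙ-refl ≡ₙ-refl ≡ₙ-refl ≡ₙ-refl
      ; sym = λ (pw p0 p1 p2 p3 p4 p5 p6) →
          pw (≡ₙ-sym p0) (≡ₙ-sym p1) (≡ₙ-sym p2) (≡ₙ-sym p3) (≡ₙ-sym p4) (≡ₙ-sym p5) (≡ₙ-sym p6)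
      ; trans = λ (pw p0 p1 p2 p3 p4 p5 p6) (pw q0 q1 q2 q3 q4 q5 q6) →
          pw (≡ₙ-trans p0 q0) (≡ₙ-trans p1 q1) (≡ₙ-trans p2 q2) (≡ₙ-trans p3 q3)
             (≡ₙ-trans p4 q4) (≡ₙ-trans p5 q5) (≡ₙ-trans p6 q6) }

    dot-cong : ∀ {x x' y y'} → x ≈ x' → y ≈ y' → dot x y ≡[ n ] dot x' y'
    dot-cong {c7 _ _ _ _ _ _ _} {c7 _ _ _ _ _ _ _} {c7 _ _ _ _ _ _ _} {c7 _ _ _ _ _ _ _}
             (pw p0 p1 p2 p3 p4 p5 p6) (pw q0 q1 q2 q3 q4 q5 q6) =
      ≡ₙ-+ (≡ₙ-+ (≡ₙ-+ (≡ₙ-+ (≡ₙ-+ (≡ₙ-+ (≡ₙ-* p0 q0) (≡ₙ-* p1 q1)) (≡ₙ-* p2 q2)) (≡ₙ-* p3 q3))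
        (≡ₙ-* p4 q4)) (≡ₙ-* p5 q5)) (≡ₙ-* p6 q6)

    backwards-cong : ∀ {y y'} → y ≈ y' → backwards y ≈ backwards y'
    backwards-cong {c7 _ _ _ _ _ _ _} {c7 _ _ _ _ _ _ _} (pw q0 q1 q2 q3 q4 q5 q6) = pw q0 q6 q5 q4 q3 q2 q1

    rotate-cong : ∀ {y y'} → y ≈ y' → rotate y ≈ rotate y'
    rotate-cong {c7 _ _ _ _ _ _ _} {c7 _ _ _ _ _ _ _} (pw q0 q1 q2 q3 q4 q5 q6) = pw q6 q0 q1 q2 q3 q4 q5

    ⊕-cong : ∀ {x x' y y'} → x ≈ x' → y ≈ y' → x ⊕ y ≈ x' ⊕ y'
    ⊕-cong {c7 _ _ _ _ _ _ _} {c7 _ _ _ _ _ _ _} {c7 _ _ _ _ _ _ _} {c7 _ _ _ _ _ _ _}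
           (pw p0 p1 p2 p3 p4 p5 p6) (pw q0 q1 q2 q3 q4 q5 q6) =
      pw (≡ₙ-+ p0 q0) (≡ₙ-+ p1 q1) (≡ₙ-+ p2 q2) (≡ₙ-+ p3 q3) (≡ₙ-+ p4 q4) (≡ₙ-+ p5 q5) (≡ₙ-+ p6 q6)

    ⊗-cong : ∀ {x x' y y'} → x ≈ x' → y ≈ y' → x ⊗ y ≈ x' ⊗ y'
    ⊗-cong p q = pw (dot-cong p q₀) (dot-cong p q₁) (dot-cong p q₂) (dot-cong p q₃)
                    (dot-cong p q₄) (dot-cong p q₅) (dot-cong p q₆)
      where
        q₀ = backwards-cong q
        q₁ = rotate-cong q₀
        q₂ = rotate-cong q₁
        q₃ = rotate-cong q₂
        q₄ = rotate-cong q₃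
        q₅ = rotate-cong q₄
        q₆ = rotate-cong q₅

    ⊖-cong : ∀ {x x'} → x ≈ x' → ⊖ x ≈ ⊖ x'
    ⊖-cong {c7 _ _ _ _ _ _ _} {c7 _ _ _ _ _ _ _} (pw p0 p1 p2 p3 p4 p5 p6) =
      pw (≡ₙ-neg p0) (≡ₙ-neg p1) (≡ₙ-neg p2) (≡ₙ-neg p3) (≡ₙ-neg p4) (≡ₙ-neg p5) (≡ₙ-neg p6)

    laws : RingLaws
    laws = record
      { Carrier = C7 ; _≈_ = _≈_ ; isEquivalence = ≈-isEquivalence
      ; _⊕_ = _⊕_ ; _⊗_ = _⊗_ ; ⊖_ = ⊖_ ; 𝟘 = 𝟘 ; 𝟙 = 𝟙
      ; ⊕-cong = ⊕-cong ; ⊗-cong = ⊗-cong ; ⊖-cong = ⊖-cong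
      ; ⊕-assoc = λ (c7 a0 a1 a2 a3 a4 a5 a6) (c7 b0 b1 b2 b3 b4 b5 b6) (c7 c0 c1 c2 c3 c4 c5 c6) →
          c7≡ (ℤP.+-assoc a0 b0 c0)
              (ℤP.+-assoc a1 b1 c1)
              (ℤP.+-assoc a2 b2 c2)
              (ℤP.+-assoc a3 b3 c3)
              (ℤP.+-assoc a4 b4 c4)
              (ℤP.+-assoc a5 b5 c5)
              (ℤP.+-assoc a6 b6 c6)
      ; ⊕-comm = λ (c7 a0 a1 a2 a3 a4 a5 a6) (c7 b0 b1 b2 b3 b4 b5 b6) →
          c7≡ (ℤP.+-comm a0 b0)
              (ℤP.+-comm a1 b1)
              (ℤP.+-comm a2 b2)
              (ℤP.+-comm a3 b3)
              (ℤP.+-comm a4 b4)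
              (ℤP.+-comm a5 b5)
              (ℤP.+-comm a6 b6)
      ; ⊕-identityˡ = λ (c7 a0 a1 a2 a3 a4 a5 a6) →
          c7≡ (ℤP.+-identityˡ a0)
              (ℤP.+-identityˡ a1)
              (ℤP.+-identityˡ a2)
              (ℤP.+-identityˡ a3)
              (ℤP.+-identityˡ a4)
              (ℤP.+-identityˡ a5)
              (ℤP.+-identityˡ a6)
      ; ⊕-identityʳ = λ (c7 a0 a1 a2 a3 a4 a5 a6) →
          c7≡ (ℤP.+-identityʳ a0)
              (ℤP.+-identityʳ a1)
              (ℤP.+-identityʳ a2)
              (ℤP.+-identityʳ a3)
              (ℤP.+-identityʳ a4)
              (ℤP.+-identityʳ a5)
              (ℤP.+-identityʳ a6)
      ; ⊖-inverseˡ = λ (c7 a0 a1 a2 a3 a4 a5 a6) →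
          c7≡ (ℤP.+-inverseˡ a0)
              (ℤP.+-inverseˡ a1)
              (ℤP.+-inverseˡ a2)
              (ℤP.+-inverseˡ a3)
              (ℤP.+-inverseˡ a4)
              (ℤP.+-inverseˡ a5)
              (ℤP.+-inverseˡ a6)
      ; ⊖-inverseʳ = λ (c7 a0 a1 a2 a3 a4 a5 a6) →
          c7≡ (ℤP.+-inverseʳ a0)
              (ℤP.+-inverseʳ a1)
              (ℤP.+-inverseʳ a2)
              (ℤP.+-inverseʳ a3)
              (ℤP.+-inverseʳ a4)
              (ℤP.+-inverseʳ a5)
              (ℤP.+-inverseʳ a6)
      ; ⊗-assoc = λ (c7 a0 a1 a2 a3 a4 a5 a6) (c7 b0 b1 b2 b3 b4 b5 b6) (c7 c0 c1 c2 c3 c4 c5 c6) →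
          c7≡ (⊗-assoc₀ a0 a1 a2 a3 a4 a5 a6 b0 b1 b2 b3 b4 b5 b6 c0 c1 c2 c3 c4 c5 c6)
              (⊗-assoc₁ a0 a1 a2 a3 a4 a5 a6 b0 b1 b2 b3 b4 b5 b6 c0 c1 c2 c3 c4 c5 c6)
              (⊗-assoc₂ a0 a1 a2 a3 a4 a5 a6 b0 b1 b2 b3 b4 b5 b6 c0 c1 c2 c3 c4 c5 c6)
              (⊗-assoc₃ a0 a1 a2 a3 a4 a5 a6 b0 b1 b2 b3 b4 b5 b6 c0 c1 c2 c3 c4 c5 c6)
              (⊗-assoc₄ a0 a1 a2 a3 a4 a5 a6 b0 b1 b2 b3 b4 b5 b6 c0 c1 c2 c3 c4 c5 c6)
              (⊗-assoc₅ a0 a1 a2 a3 a4 a5 a6 b0 b1 b2 b3 b4 b5 b6 c0 c1 c2 c3 c4 c5 c6)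
              (⊗-assoc₆ a0 a1 a2 a3 a4 a5 a6 b0 b1 b2 b3 b4 b5 b6 c0 c1 c2 c3 c4 c5 c6)
      ; ⊗-comm = λ (c7 a0 a1 a2 a3 a4 a5 a6) (c7 b0 b1 b2 b3 b4 b5 b6) →
          c7≡ (⊗-comm₀ a0 a1 a2 a3 a4 a5 a6 b0 b1 b2 b3 b4 b5 b6)
              (⊗-comm₁ a0 a1 a2 a3 a4 a5 a6 b0 b1 b2 b3 b4 b5 b6)
              (⊗-comm₂ a0 a1 a2 a3 a4 a5 a6 b0 b1 b2 b3 b4 b5 b6)
              (⊗-comm₃ a0 a1 a2 a3 a4 a5 a6 b0 b1 b2 b3 b4 b5 b6)
              (⊗-comm₄ a0 a1 a2 a3 a4 a5 a6 b0 b1 b2 b3 b4 b5 b6)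
              (⊗-comm₅ a0 a1 a2 a3 a4 a5 a6 b0 b1 b2 b3 b4 b5 b6)
              (⊗-comm₆ a0 a1 a2 a3 a4 a5 a6 b0 b1 b2 b3 b4 b5 b6)
      ; ⊗-identityˡ = λ (c7 a0 a1 a2 a3 a4 a5 a6) →
          c7≡ (⊗-identityˡ₀ a0 a1 a2 a3 a4 a5 a6)
              (⊗-identityˡ₁ a0 a1 a2 a3 a4 a5 a6)
              (⊗-identityˡ₂ a0 a1 a2 a3 a4 a5 a6)
              (⊗-identityˡ₃ a0 a1 a2 a3 a4 a5 a6)
              (⊗-identityˡ₄ a0 a1 a2 a3 a4 a5 a6)
              (⊗-identityˡ₅ a0 a1 a2 a3 a4 a5 a6)
              (⊗-identityˡ₆ a0 a1 a2 a3 a4 a5 a6)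
      ; ⊗-identityʳ = λ (c7 a0 a1 a2 a3 a4 a5 a6) →
          c7≡ (⊗-identityʳ₀ a0 a1 a2 a3 a4 a5 a6)
              (⊗-identityʳ₁ a0 a1 a2 a3 a4 a5 a6)
              (⊗-identityʳ₂ a0 a1 a2 a3 a4 a5 a6)
              (⊗-identityʳ₃ a0 a1 a2 a3 a4 a5 a6)
              (⊗-identityʳ₄ a0 a1 a2 a3 a4 a5 a6)
              (⊗-identityʳ₅ a0 a1 a2 a3 a4 a5 a6)
              (⊗-identityʳ₆ a0 a1 a2 a3 a4 a5 a6)
      ; distribˡ = λ (c7 a0 a1 a2 a3 a4 a5 a6) (c7 b0 b1 b2 b3 b4 b5 b6) (c7 c0 c1 c2 c3 c4 c5 c6) →
          c7≡ (distribˡ₀ a0 a1 a2 a3 a4 a5 a6 b0 b1 b2 b3 b4 b5 b6 c0 c1 c2 c3 c4 c5 c6)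
              (distribˡ₁ a0 a1 a2 a3 a4 a5 a6 b0 b1 b2 b3 b4 b5 b6 c0 c1 c2 c3 c4 c5 c6)
              (distribˡ₂ a0 a1 a2 a3 a4 a5 a6 b0 b1 b2 b3 b4 b5 b6 c0 c1 c2 c3 c4 c5 c6)
              (distribˡ₃ a0 a1 a2 a3 a4 a5 a6 b0 b1 b2 b3 b4 b5 b6 c0 c1 c2 c3 c4 c5 c6)
              (distribˡ₄ a0 a1 a2 a3 a4 a5 a6 b0 b1 b2 b3 b4 b5 b6 c0 c1 c2 c3 c4 c5 c6)
              (distribˡ₅ a0 a1 a2 a3 a4 a5 a6 b0 b1 b2 b3 b4 b5 b6 c0 c1 c2 c3 c4 c5 c6)
              (distribˡ₆ a0 a1 a2 a3 a4 a5 a6 b0 b1 b2 b3 b4 b5 b6 c0 c1 c2 c3 c4 c5 c6)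
      ; distribʳ = λ (c7 a0 a1 a2 a3 a4 a5 a6) (c7 b0 b1 b2 b3 b4 b5 b6) (c7 c0 c1 c2 c3 c4 c5 c6) →
          c7≡ (distribʳ₀ a0 a1 a2 a3 a4 a5 a6 b0 b1 b2 b3 b4 b5 b6 c0 c1 c2 c3 c4 c5 c6)
              (distribʳ₁ a0 a1 a2 a3 a4 a5 a6 b0 b1 b2 b3 b4 b5 b6 c0 c1 c2 c3 c4 c5 c6)
              (distribʳ₂ a0 a1 a2 a3 a4 a5 a6 b0 b1 b2 b3 b4 b5 b6 c0 c1 c2 c3 c4 c5 c6)
              (distribʳ₃ a0 a1 a2 a3 a4 a5 a6 b0 b1 b2 b3 b4 b5 b6 c0 c1 c2 c3 c4 c5 c6)
              (distribʳ₄ a0 a1 a2 a3 a4 a5 a6 b0 b1 b2 b3 b4 b5 b6 c0 c1 c2 c3 c4 c5 c6)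
              (distribʳ₅ a0 a1 a2 a3 a4 a5 a6 b0 b1 b2 b3 b4 b5 b6 c0 c1 c2 c3 c4 c5 c6)
              (distribʳ₆ a0 a1 a2 a3 a4 a5 a6 b0 b1 b2 b3 b4 b5 b6 c0 c1 c2 c3 c4 c5 c6)
      }

    ring : CommutativeRing 0ℓ 0ℓ
    ring = toCommutativeRing laws

    open CommutativeRing ring public
      using (setoid; refl; sym; trans; reflexive; +-cong; -‿cong; +-congˡ; *-congʳ; *-congˡ)
    open RingFacts ring public
    open import Algebra.Properties.Monoid.Mult (CommutativeRing.+-monoid ring) public using (_×_)

    ι : ℤ → C7
    ι z = c7 z (+ 0) (+ 0) (+ 0) (+ 0) (+ 0) (+ 0)

    private
      ι-*₀ : ∀ (z w : ℤ) →
          (z * w)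
        ≡
          z * w + (+ 0) * (+ 0) + (+ 0) * (+ 0) + (+ 0) * (+ 0) + (+ 0) * (+ 0) + (+ 0) * (+ 0)
          + (+ 0) * (+ 0)
      ι-*₀ = solve-∀
      ι-*₁ : ∀ (z w : ℤ) →
          (+ 0)
        ≡
          z * (+ 0) + (+ 0) * w + (+ 0) * (+ 0) + (+ 0) * (+ 0) + (+ 0) * (+ 0) + (+ 0) * (+ 0)
          + (+ 0) * (+ 0)
      ι-*₁ = solve-∀
      ι-*₂ : ∀ (z w : ℤ) →
          (+ 0)
        ≡
          z * (+ 0) + (+ 0) * (+ 0) + (+ 0) * w + (+ 0) * (+ 0) + (+ 0) * (+ 0) + (+ 0) * (+ 0)
          + (+ 0) * (+ 0)
      ι-*₂ = solve-∀
      ι-*₃ : ∀ (z w : ℤ) →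
          (+ 0)
        ≡
          z * (+ 0) + (+ 0) * (+ 0) + (+ 0) * (+ 0) + (+ 0) * w + (+ 0) * (+ 0) + (+ 0) * (+ 0)
          + (+ 0) * (+ 0)
      ι-*₃ = solve-∀
      ι-*₄ : ∀ (z w : ℤ) →
          (+ 0)
        ≡
          z * (+ 0) + (+ 0) * (+ 0) + (+ 0) * (+ 0) + (+ 0) * (+ 0) + (+ 0) * w + (+ 0) * (+ 0)
          + (+ 0) * (+ 0)
      ι-*₄ = solve-∀
      ι-*₅ : ∀ (z w : ℤ) →
          (+ 0)
        ≡
          z * (+ 0) + (+ 0) * (+ 0) + (+ 0) * (+ 0) + (+ 0) * (+ 0) + (+ 0) * (+ 0) + (+ 0) * w
          + (+ 0) * (+ 0)
      ι-*₅ = solve-∀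
      ι-*₆ : ∀ (z w : ℤ) →
          (+ 0)
        ≡
          z * (+ 0) + (+ 0) * (+ 0) + (+ 0) * (+ 0) + (+ 0) * (+ 0) + (+ 0) * (+ 0) + (+ 0) * (+ 0)
          + (+ 0) * w
      ι-*₆ = solve-∀
      scale₀ : ∀ (z x0 x1 x2 x3 x4 x5 x6 : ℤ) →
          z * x0 + (+ 0) * x6 + (+ 0) * x5 + (+ 0) * x4 + (+ 0) * x3 + (+ 0) * x2 + (+ 0) * x1
        ≡
          z * x0
      scale₀ = solve-∀
      scale₁ : ∀ (z x0 x1 x2 x3 x4 x5 x6 : ℤ) →
          z * x1 + (+ 0) * x0 + (+ 0) * x6 + (+ 0) * x5 + (+ 0) * x4 + (+ 0) * x3 + (+ 0) * x2
        ≡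
          z * x1
      scale₁ = solve-∀
      scale₂ : ∀ (z x0 x1 x2 x3 x4 x5 x6 : ℤ) →
          z * x2 + (+ 0) * x1 + (+ 0) * x0 + (+ 0) * x6 + (+ 0) * x5 + (+ 0) * x4 + (+ 0) * x3
        ≡
          z * x2
      scale₂ = solve-∀
      scale₃ : ∀ (z x0 x1 x2 x3 x4 x5 x6 : ℤ) →
          z * x3 + (+ 0) * x2 + (+ 0) * x1 + (+ 0) * x0 + (+ 0) * x6 + (+ 0) * x5 + (+ 0) * x4
        ≡
          z * x3
      scale₃ = solve-∀
      scale₄ : ∀ (z x0 x1 x2 x3 x4 x5 x6 : ℤ) →
          z * x4 + (+ 0) * x3 + (+ 0) * x2 + (+ 0) * x1 + (+ 0) * x0 + (+ 0) * x6 + (+ 0) * x5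
        ≡
          z * x4
      scale₄ = solve-∀
      scale₅ : ∀ (z x0 x1 x2 x3 x4 x5 x6 : ℤ) →
          z * x5 + (+ 0) * x4 + (+ 0) * x3 + (+ 0) * x2 + (+ 0) * x1 + (+ 0) * x0 + (+ 0) * x6
        ≡
          z * x5
      scale₅ = solve-∀
      scale₆ : ∀ (z x0 x1 x2 x3 x4 x5 x6 : ℤ) →
          z * x6 + (+ 0) * x5 + (+ 0) * x4 + (+ 0) * x3 + (+ 0) * x2 + (+ 0) * x1 + (+ 0) * x0
        ≡
          z * x6
      scale₆ = solve-∀

    ι-* : ∀ z w → ι (z * w) ≈ ι z ⊗ ι w
    ι-* z w = reflexive (c7≡ (ι-*₀ z w) (ι-*₁ z w) (ι-*₂ z w) (ι-*₃ z w) (ι-*₄ z w) (ι-*₅ z w) (ι-*₆ z w))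

    ι-^ : ∀ z k → ι (z ℤ.^ k) ≈ ι z ^ k
    ι-^ z zero = refl
    ι-^ z (suc k) = trans (ι-* z (z ℤ.^ k)) (*-congˡ {ι z} (ι-^ z k))

    ι-scale : ∀ z X → ι z ⊗ X ≈ c7 (z * co0 X) (z * co1 X) (z * co2 X) (z * co3 X) (z * co4 X) (z * co5 X) (z * co6 X)
    ι-scale z (c7 x0 x1 x2 x3 x4 x5 x6) = reflexive (c7≡ (scale₀ z x0 x1 x2 x3 x4 x5 x6)
      (scale₁ z x0 x1 x2 x3 x4 x5 x6) (scale₂ z x0 x1 x2 x3 x4 x5 x6) (scale₃ z x0 x1 x2 x3 x4 x5 x6)
      (scale₄ z x0 x1 x2 x3 x4 x5 x6) (scale₅ z x0 x1 x2 x3 x4 x5 x6) (scale₆ z x0 x1 x2 x3 x4 x5 x6))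

    ι-× : ∀ k → k × 𝟙 ≈ ι (+ k)
    ι-× zero = refl
    ι-× (suc k) = +-congˡ {𝟙} (ι-× k)

    characteristic : n × 𝟙 ≈ 𝟘
    characteristic = trans (ι-× n) (pw ≡ₙ-modulus ≡ₙ-refl ≡ₙ-refl ≡ₙ-refl ≡ₙ-refl ≡ₙ-refl ≡ₙ-refl)

    module PrimeModulus (prime : Prime n) where
      open Frobenius.PrimeCharacteristic ring using (freshman; freshman-neg)

      frob : ∀ x y → (x ⊕ y) ^ n ≈ x ^ n ⊕ y ^ n
      frob = freshman n prime characteristic

      frob-neg : ∀ x → (⊖ x) ^ n ≈ ⊖ (x ^ n)
      frob-neg = freshman-neg n prime characteristic

module QuadraticCharacters where

  open import Data.Nat as ℕ using (ℕ; suc)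
  open import Data.Nat.Primality using (Prime)
  open import Data.Integer as ℤ using (ℤ; +_; -[1+_]; _*_)
  import Data.Integer.Properties as ℤP
  open import Data.Product using (_,_)
  open import Data.Sum using (_⊎_; inj₁; inj₂)
  open import Relation.Binary.PropositionalEquality as ≡ using (_≡_)
  open import Data.Nat.Tactic.RingSolver using (solve-∀)
  open Congruence

  -- Euler's criterion for -3 and -7 modulo a prime N = 2u + 1: in a ring containing an
  -- element g with g³ = c g (c ∈ {-3, -7}) built from roots of unity, the Frobenius map
  -- computes g^N = -g, while g^N = c^u g directly; comparing a coordinate gives c^u ≡ -1.
  module _ (N : ℕ) (prime : Prime N) (u : ℕ) (N≡2u+1 : N ≡ suc (u ℕ.+ u)) where

    -- -3 is a non-residue modulo N when N ≡ 2 (mod 3).  Work in (ℤ/N)[ω], ω² = -ω - 1,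
    -- with g = 1 + 2ω, g² = -3: then ω^N = ω² and g^N = 1 + 2ω² = -g.
    minus-3-nonresidue : ∀ s → N ≡ 3 ℕ.* s ℕ.+ 2 → -[1+ 2 ] ℤ.^ u ≡[ N ] -[1+ 0 ]
    minus-3-nonresidue s N≡3s+2 =
      ≡ₙ-trans (≡ₙ-reflexive (≡.sym (ℤP.*-identityʳ _))) (≈₀ (trans (sym (ι-scale (-[1+ 2 ] ℤ.^ u) g)) c^u*g=-g))
      where
        open QuadraticRing N (-[1+ 0 ]) (-[1+ 0 ])
        open PrimeModulus prime
        open import Relation.Binary.Reasoning.Setoid setoid

        ω g : Q
        ω = (+ 0 , + 1)
        g = (+ 1 , + 2)

        ωᴺ : ω ^ N ≈ ω ^ 2
        ωᴺ = trans (^-congʳ ω N≡3s+2) (^-period ω 3 refl s 2)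

        gᴺ-frobenius : g ^ N ≈ ⊖ g
        gᴺ-frobenius = begin
          g ^ N                          ≈⟨ frob 𝟙 (ι (+ 2) ⊗ ω) ⟩
          𝟙 ^ N ⊕ (ι (+ 2) ⊗ ω) ^ N      ≈⟨ +-cong (1^ N) (^-distrib-* (ι (+ 2)) ω N) ⟩
          𝟙 ⊕ ι (+ 2) ^ N ⊗ ω ^ N        ≈⟨ +-congˡ {𝟙} (*-cong (fermat-ι (+ 2)) ωᴺ) ⟩
          𝟙 ⊕ ι (+ 2) ⊗ ω ^ 2            ≈⟨ refl ⟩
          ⊖ g                            ∎

        c^u*g=-g : ι (-[1+ 2 ] ℤ.^ u) ⊗ g ≈ ⊖ g
        c^u*g=-g = begin
          ι (-[1+ 2 ] ℤ.^ u) ⊗ g     ≈⟨ *-congʳ (ι-^ (-[1+ 2 ]) u) ⟩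
          ι (-[1+ 2 ]) ^ u ⊗ g       ≈⟨ ^-odd-eigen g (ι (-[1+ 2 ])) refl u ⟨
          g ^ suc (u ℕ.+ u)          ≈⟨ ^-congʳ g N≡2u+1 ⟨
          g ^ N                      ≈⟨ gᴺ-frobenius ⟩
          ⊖ g                        ∎

    -- Work in (ℤ/N)[ζ], ζ⁷ = 1,
    -- with the Gauss sum G = Σ (i/7) ζⁱ, G³ = -7 G: the non-residues 3, 5, 6 permute
    -- the exponents so that G^N = Σ (i/7) ζ^(N i) = -G.
    minus-7-nonresidue : ∀ q r → N ≡ 7 ℕ.* q ℕ.+ r → r ≡ 3 ⊎ r ≡ 5 ⊎ r ≡ 6 → -[1+ 6 ] ℤ.^ u ≡[ N ] -[1+ 0 ]
    minus-7-nonresidue q r N≡7q+r r-nonresidue =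
      ≡ₙ-trans (≡ₙ-reflexive (≡.sym (ℤP.*-identityʳ _))) (r1 (trans (sym (ι-scale (-[1+ 6 ] ℤ.^ u) G)) c^u*G=-G))
      where
        open Cyclotomic using (C7; c7; r1; _⊕_; _⊗_; ⊖_)
        open Cyclotomic.CyclotomicRing N
        open PrimeModulus prime
        open import Relation.Binary.Reasoning.Setoid setoid

        ζ : C7
        ζ = c7 (+ 0) (+ 1) (+ 0) (+ 0) (+ 0) (+ 0) (+ 0)

        T : ℕ → C7
        T j = ζ ^ j

        gauss : (ℕ → ℕ) → C7
        gauss f = T (f 1) ⊕ T (f 2) ⊕ T (f 4) ⊕ ⊖ T (f 3) ⊕ ⊖ T (f 5) ⊕ ⊖ T (f 6)

        G : C7
        G = gauss (λ j → j)

        Tᴺ : ∀ j → T j ^ N ≈ T (j ℕ.* r)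
        Tᴺ j = begin
          (ζ ^ j) ^ N                      ≈⟨ ^-assocʳ ζ j N ⟩
          ζ ^ (j ℕ.* N)                    ≡⟨ ≡.cong (λ x → ζ ^ (j ℕ.* x)) N≡7q+r ⟩
          ζ ^ (j ℕ.* (7 ℕ.* q ℕ.+ r))      ≡⟨ ≡.cong (ζ ^_) (expand j q r) ⟩
          ζ ^ (7 ℕ.* (j ℕ.* q) ℕ.+ j ℕ.* r) ≈⟨ ^-period ζ 7 refl (j ℕ.* q) (j ℕ.* r) ⟩
          ζ ^ (j ℕ.* r)                    ∎
          where
            expand : ∀ j q r → j ℕ.* (7 ℕ.* q ℕ.+ r) ≡ 7 ℕ.* (j ℕ.* q) ℕ.+ j ℕ.* r
            expand = solve-∀

        frob-+ : ∀ x y {x' y'} → x ^ N ≈ x' → y ^ N ≈ y' → (x ⊕ y) ^ N ≈ x' ⊕ y'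
        frob-+ x y xᴺ yᴺ = trans (frob x y) (+-cong xᴺ yᴺ)

        frob-⊖ : ∀ x {x'} → x ^ N ≈ x' → (⊖ x) ^ N ≈ ⊖ x'
        frob-⊖ x xᴺ = trans (frob-neg x) (-‿cong xᴺ)

        Gᴺ-frobenius : G ^ N ≈ gauss (λ j → j ℕ.* r)
        Gᴺ-frobenius =
          frob-+ (T 1 ⊕ T 2 ⊕ T 4 ⊕ ⊖ T 3 ⊕ ⊖ T 5) (⊖ T 6)
            (frob-+ (T 1 ⊕ T 2 ⊕ T 4 ⊕ ⊖ T 3) (⊖ T 5)
              (frob-+ (T 1 ⊕ T 2 ⊕ T 4) (⊖ T 3)
                (frob-+ (T 1 ⊕ T 2) (T 4) (frob-+ (T 1) (T 2) (Tᴺ 1) (Tᴺ 2)) (Tᴺ 4))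
                (frob-⊖ (T 3) (Tᴺ 3)))
              (frob-⊖ (T 5) (Tᴺ 5)))
            (frob-⊖ (T 6) (Tᴺ 6))

        permuted : ∀ {r} → r ≡ 3 ⊎ r ≡ 5 ⊎ r ≡ 6 → gauss (λ j → j ℕ.* r) ≈ ⊖ G
        permuted (inj₁ ≡.refl) = refl
        permuted (inj₂ (inj₁ ≡.refl)) = refl
        permuted (inj₂ (inj₂ ≡.refl)) = refl

        Gᴺ=-G : G ^ N ≈ ⊖ G
        Gᴺ=-G = trans Gᴺ-frobenius (permuted r-nonresidue)

        c^u*G=-G : ι (-[1+ 6 ] ℤ.^ u) ⊗ G ≈ ⊖ G
        c^u*G=-G = begin
          ι (-[1+ 6 ] ℤ.^ u) ⊗ G     ≈⟨ *-congʳ (ι-^ (-[1+ 6 ]) u) ⟩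
          ι (-[1+ 6 ]) ^ u ⊗ G       ≈⟨ ^-odd-eigen G (ι (-[1+ 6 ])) refl u ⟨
          G ^ suc (u ℕ.+ u)          ≈⟨ ^-congʳ G N≡2u+1 ⟨
          G ^ N                      ≈⟨ Gᴺ=-G ⟩
          ⊖ G                        ∎

-- The ring (ℤ/n)[α] with α² = 5α - 1, where the Lucas sequence V(5,1) lives:
-- α and β = 5 - α are the roots of x² - 5x + 1, and w = 2α - 5 is a square root of
-- the discriminant 21.
module LucasRing (n : ℕ) where
  open import Algebra.Bundles using (CommutativeRing)
  open import Data.Nat as ℕ using (ℕ; suc)
  open import Data.Nat.Primality using (Prime)
  open import Data.Integer using (+_; -[1+_])
  open import Data.Product using (_,_)
  open import Relation.Binary.PropositionalEquality as ≡ using (_≡_)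
  open import Data.Nat.Tactic.RingSolver using (solve-∀)
  open import Defs using (V; S)

  open QuadraticRing n (+ 5) (-[1+ 0 ]) public
  open import Relation.Binary.Reasoning.Setoid setoid
  open import Algebra.Properties.Group (CommutativeRing.+-group ring) using (inverseʳ-unique)
  open import Algebra.Properties.Ring (CommutativeRing.ring ring) using (-1*x≈-x)

  α β w : Q
  α = (+ 0 , + 1)
  β = (+ 5 , -[1+ 0 ])
  w = (-[1+ 4 ] , + 2)

  αβ=1 : α ⊗ β ≈ 𝟙
  αβ=1 = refl

  lucas-relation : ∀ k j → ι (S j (V (+ 5) (+ 1) k)) ≈ α ^ (k ℕ.* 2 ℕ.^ j) ⊕ β ^ (k ℕ.* 2 ℕ.^ j)
  lucas-relation k j = begin
    ι (S j (V (+ 5) (+ 1) k))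
      ≈⟨ lucas-S _ (α ^ k) (β ^ k) (lucas-V (+ 5) (+ 1) α β refl refl k) (inverse-^ α β αβ=1 k) j ⟩
    (α ^ k) ^ (2 ℕ.^ j) ⊕ (β ^ k) ^ (2 ℕ.^ j)
      ≈⟨ +-cong (^-assocʳ α k (2 ℕ.^ j)) (^-assocʳ β k (2 ℕ.^ j)) ⟩
    α ^ (k ℕ.* 2 ℕ.^ j) ⊕ β ^ (k ℕ.* 2 ℕ.^ j) ∎

  -- Since β = α⁻¹:  α^t + β^t = 0  iff  α^(2t) = -1.
  sum-zero⇒square-minus-one : ∀ t → α ^ t ⊕ β ^ t ≈ 𝟘 → α ^ (t ℕ.+ t) ≈ ⊖ 𝟙
  sum-zero⇒square-minus-one t sum=0 = inverseʳ-unique 𝟙 (α ^ (t ℕ.+ t)) (begin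
    𝟙 ⊕ α ^ (t ℕ.+ t)                ≈⟨ +-comm 𝟙 (α ^ (t ℕ.+ t)) ⟩
    α ^ (t ℕ.+ t) ⊕ 𝟙                ≈⟨ +-cong (^-homo-* α t t) (sym (inverse-^ α β αβ=1 t)) ⟩
    α ^ t ⊗ α ^ t ⊕ α ^ t ⊗ β ^ t    ≈⟨ distribˡ (α ^ t) (α ^ t) (β ^ t) ⟨
    α ^ t ⊗ (α ^ t ⊕ β ^ t)          ≈⟨ *-congˡ {α ^ t} sum=0 ⟩
    α ^ t ⊗ 𝟘                        ≈⟨ zeroʳ (α ^ t) ⟩
    𝟘                                ∎)

  square-minus-one⇒sum-zero : ∀ t → α ^ (t ℕ.+ t) ≈ ⊖ 𝟙 → α ^ t ⊕ β ^ t ≈ 𝟘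
  square-minus-one⇒sum-zero t α^2t=-1 = begin
    α ^ t ⊕ β ^ t                    ≈⟨ +-congʳ αᵗ=-βᵗ ⟩
    ⊖ 𝟙 ⊗ β ^ t ⊕ β ^ t              ≈⟨ +-congʳ (-1*x≈-x (β ^ t)) ⟩
    ⊖ (β ^ t) ⊕ β ^ t                ≈⟨ -‿inverseˡ (β ^ t) ⟩
    𝟘                                ∎
    where
      αᵗ=-βᵗ : α ^ t ≈ ⊖ 𝟙 ⊗ β ^ t
      αᵗ=-βᵗ = begin
        α ^ t                        ≈⟨ *-identityʳ (α ^ t) ⟨
        α ^ t ⊗ 𝟙                    ≈⟨ *-congˡ {α ^ t} (inverse-^ α β αβ=1 t) ⟨
        α ^ t ⊗ (α ^ t ⊗ β ^ t)      ≈⟨ *-assoc (α ^ t) (α ^ t) (β ^ t) ⟨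
        (α ^ t ⊗ α ^ t) ⊗ β ^ t      ≈⟨ *-congʳ (^-homo-* α t t) ⟨
        α ^ (t ℕ.+ t) ⊗ β ^ t        ≈⟨ *-congʳ α^2t=-1 ⟩
        ⊖ 𝟙 ⊗ β ^ t                  ∎

  -- Modulo an odd prime n = 2v + 1, the Frobenius image of α is read off from that of w,
  -- and w^n = 21^v w is Euler's criterion for the discriminant.
  module OddPrimeModulus (prime : Prime n) (v : ℕ) (n≡2v+1 : n ≡ suc (v ℕ.+ v)) where
    open PrimeModulus prime public

    half : ι (+ suc v) ⊗ ι (+ 2) ≈ 𝟙
    half = ι-unit (suc v) 2 1 (≡.trans (twice v) (≡.cong (λ x → 1 ℕ.* x ℕ.+ 1) (≡.sym n≡2v+1)))
      where
        twice : ∀ v → suc v ℕ.* 2 ≡ 1 ℕ.* suc (v ℕ.+ v) ℕ.+ 1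
        twice = solve-∀

    wⁿ-euler : w ^ n ≈ ι (+ 21) ^ v ⊗ w
    wⁿ-euler = trans (^-congʳ w n≡2v+1) (^-odd-eigen w (ι (+ 21)) refl v)

    wⁿ-frobenius : w ^ n ≈ ι (+ 2) ⊗ α ^ n ⊕ ι (-[1+ 4 ])
    wⁿ-frobenius = begin
      w ^ n                                         ≈⟨ frob (ι (+ 2) ⊗ α) (ι (-[1+ 4 ])) ⟩
      (ι (+ 2) ⊗ α) ^ n ⊕ ι (-[1+ 4 ]) ^ n          ≈⟨ +-cong (^-distrib-* (ι (+ 2)) α n) (fermat-ι (-[1+ 4 ])) ⟩
      ι (+ 2) ^ n ⊗ α ^ n ⊕ ι (-[1+ 4 ])            ≈⟨ +-congʳ (*-congʳ (fermat-ι (+ 2))) ⟩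
      ι (+ 2) ⊗ α ^ n ⊕ ι (-[1+ 4 ])                ∎

    αⁿ-from-wⁿ : ∀ Y → w ^ n ≈ ι (+ 2) ⊗ Y ⊕ ι (-[1+ 4 ]) → α ^ n ≈ Y
    αⁿ-from-wⁿ Y wⁿ=2Y-5 =
      *-cancelˡ-unit (ι (+ suc v)) (ι (+ 2)) half (+-cancelʳ (ι (-[1+ 4 ])) (trans (sym wⁿ-frobenius) wⁿ=2Y-5))

module Necessity where

  open import Data.Nat as ℕ using (ℕ; suc)
  open import Data.Nat.Primality using (Prime)
  open import Data.Integer as ℤ using (ℤ; +_; -[1+_])
  import Data.Integer.Divisibility as ℤD
  open import Data.Product using (_,_)
  open import Relation.Binary.PropositionalEquality as ≡ using (_≡_)
  open import Data.Nat.Tactic.RingSolver using (solve-∀)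
  open import Defs using (V; S)
  open Congruence

  -- Necessity: let N = 4t + 1 be prime with N ≡ 2 (mod 3), and suppose -3 and -7 are
  -- quadratic non-residues modulo N, i.e. (-3)^(2t) ≡ (-7)^(2t) ≡ -1.  Then in
  -- (ℤ/N)[α] the discriminant 21 is a square, so α^N = α, while δ = α - 1 with
  -- δ² = 3α gives (3α)^(2t) = 1 and hence α^(2t) = -1, i.e. α^t + β^t = 0.
  module _ (N : ℕ) (prime : Prime N) (t : ℕ) (N≡4t+1 : N ≡ suc ((t ℕ.+ t) ℕ.+ (t ℕ.+ t)))
           (s : ℕ) (N≡3s+2 : N ≡ 3 ℕ.* s ℕ.+ 2)
           (minus-3 : -[1+ 2 ] ℤ.^ (t ℕ.+ t) ≡[ N ] -[1+ 0 ])
           (minus-7 : -[1+ 6 ] ℤ.^ (t ℕ.+ t) ≡[ N ] -[1+ 0 ]) where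

    open LucasRing N
    open OddPrimeModulus prime (t ℕ.+ t) N≡4t+1
    open import Relation.Binary.Reasoning.Setoid setoid

    private
      u = t ℕ.+ t
      minus-one = ι (-[1+ 0 ])

    -- 3 is a unit: 3 (s + 1) = N + 1.
    third : ι (+ suc s) ⊗ ι (+ 3) ≈ 𝟙
    third = ι-unit (suc s) 3 1 (≡.trans (thrice s) (≡.cong (λ x → 1 ℕ.* x ℕ.+ 1) (≡.sym N≡3s+2)))
      where
        thrice : ∀ s → suc s ℕ.* 3 ≡ 1 ℕ.* (3 ℕ.* s ℕ.+ 2) ℕ.+ 1
        thrice = solve-∀

    -- 21 = (-3)(-7) is a quadratic residue, so the Frobenius map fixes w and α.
    wᴺ=w : w ^ N ≈ w
    wᴺ=w = begin
      w ^ N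
        ≈⟨ wⁿ-euler ⟩
      ι (+ 21) ^ u ⊗ w
        ≈⟨ *-congʳ (^-distrib-* (ι (-[1+ 2 ])) (ι (-[1+ 6 ])) u) ⟩
      (ι (-[1+ 2 ]) ^ u ⊗ ι (-[1+ 6 ]) ^ u) ⊗ w
        ≈⟨ *-congʳ (*-cong (residue minus-3) (residue minus-7)) ⟩
      (minus-one ⊗ minus-one) ⊗ w
        ≈⟨ refl ⟩
      w ∎
      where
        residue : ∀ {c} → c ℤ.^ u ≡[ N ] -[1+ 0 ] → ι c ^ u ≈ minus-one
        residue {c} cᵘ = trans (sym (ι-^ c u)) (ι-cong cᵘ)

    αᴺ=α : α ^ N ≈ α
    αᴺ=α = αⁿ-from-wⁿ α wᴺ=w

    -- δ = α - 1 satisfies δ² = 3α and δ^N = δ, so δ (3α)^u = δ^N = δ.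
    δ : Q
    δ = α ⊕ ⊖ 𝟙

    δᴺ=δ : δ ^ N ≈ δ
    δᴺ=δ = trans (frob α (⊖ 𝟙)) (+-cong αᴺ=α (trans (frob-neg 𝟙) (-‿cong (1^ N))))

    [3α]ᵘ=1 : (ι (+ 3) ⊗ α) ^ u ≈ 𝟙
    [3α]ᵘ=1 = *-cancelˡ-unit (ι (+ suc s)) (ι (+ 3)) third (begin
      ι (+ 3) ⊗ X                 ≈⟨ refl ⟩
      (ε ⊗ δ) ⊗ X                 ≈⟨ *-assoc ε δ X ⟩
      ε ⊗ (δ ⊗ (δ ⊗ δ) ^ u)       ≈⟨ *-congˡ {ε} (trans (sym (^-odd δ u)) δ^[2u+1]=δ) ⟩
      ε ⊗ δ                       ≈⟨ refl ⟩
      ι (+ 3) ⊗ 𝟙                 ∎)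
      where
        X = (ι (+ 3) ⊗ α) ^ u
        δ^[2u+1]=δ : δ ^ suc (u ℕ.+ u) ≈ δ
        δ^[2u+1]=δ = trans (sym (^-congʳ δ N≡4t+1)) δᴺ=δ
        -- ε = α - 4 is a cofactor of δ: ε δ = 3.
        ε : Q
        ε = (-[1+ 3 ] , + 1)

    -- u is even, so 3^u = (-3)^u = -1, and therefore α^u = -1.
    3ᵘ=-1 : ι (+ 3) ^ u ≈ minus-one
    3ᵘ=-1 = begin
      ι (+ 3) ^ (t ℕ.+ t)                      ≈⟨ ^-double (ι (+ 3)) t ⟩
      (ι (+ 3) ⊗ ι (+ 3)) ^ t                  ≈⟨ refl ⟩
      (ι (-[1+ 2 ]) ⊗ ι (-[1+ 2 ])) ^ t        ≈⟨ ^-double (ι (-[1+ 2 ])) t ⟨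
      ι (-[1+ 2 ]) ^ (t ℕ.+ t)                 ≈⟨ sym (ι-^ (-[1+ 2 ]) u) ⟩
      ι (-[1+ 2 ] ℤ.^ u)                       ≈⟨ ι-cong minus-3 ⟩
      minus-one                                ∎

    αᵘ=-1 : α ^ u ≈ ⊖ 𝟙
    αᵘ=-1 = begin
      α ^ u                              ≈⟨ *-identityˡ (α ^ u) ⟨
      (minus-one ⊗ minus-one) ⊗ α ^ u    ≈⟨ *-assoc minus-one minus-one (α ^ u) ⟩
      minus-one ⊗ (minus-one ⊗ α ^ u)    ≈⟨ *-congˡ {minus-one} (*-congʳ {α ^ u} 3ᵘ=-1) ⟨
      minus-one ⊗ (ι (+ 3) ^ u ⊗ α ^ u)  ≈⟨ *-congˡ {minus-one} (trans (sym (^-distrib-* (ι (+ 3)) α u)) [3α]ᵘ=1) ⟩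
      minus-one ⊗ 𝟙                      ≈⟨ refl ⟩
      ⊖ 𝟙                                ∎

    N∣S : ∀ k j → t ≡ k ℕ.* 2 ℕ.^ j → (+ N) ℤD.∣ S j (V (+ 5) (+ 1) k)
    N∣S k j t≡k2ʲ = ≡ₙ0⇒∣ (≈₀ (begin
      ι (S j (V (+ 5) (+ 1) k))                      ≈⟨ lucas-relation k j ⟩
      α ^ (k ℕ.* 2 ℕ.^ j) ⊕ β ^ (k ℕ.* 2 ℕ.^ j)      ≡⟨ ≡.cong (λ e → α ^ e ⊕ β ^ e) (≡.sym t≡k2ʲ) ⟩
      α ^ t ⊕ β ^ t                                  ≈⟨ square-minus-one⇒sum-zero t αᵘ=-1 ⟩
      𝟘                                              ∎))

module Sufficiency where

  open import Data.Nat as ℕ using (ℕ; zero; suc; _≤_; _<_; s≤s; z≤n)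
  import Data.Nat.Properties as ℕP
  open import Data.Nat.Primality using (Prime)
  open import Data.Nat.Divisibility using (_∣_; ∣⇒≤)
  open import Data.Integer as ℤ using (ℤ; +_; -[1+_]; _*_)
  import Data.Integer.Properties as ℤP
  import Data.Integer.Divisibility as ℤD
  open import Data.Sum using (_⊎_; inj₁; inj₂)
  open import Relation.Nullary using (¬_)
  open import Data.Empty using (⊥-elim)
  open import Relation.Binary.PropositionalEquality as ≡ using (_≡_)
  open import Data.Nat.Tactic.RingSolver using (solve-∀)
  open import Defs using (V; S)
  open Congruence
  open Frobenius using (prime>1)

  -- Sufficiency: let p = 2v + 1 be a prime not dividing 21 that divides some N with
  -- N | S_j(V_k(5,1)).  Then α^(k 2^(j+1)) = -1 in (ℤ/p)[α], while Euler's criterion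
  -- 21^v ≡ ±1 makes α^p equal to α or to β = α⁻¹, so α^(p-1) = 1 or α^(p+1) = 1.
  -- Hence 2^(j+2) divides p - 1 or p + 1, and 2^(j+2) ≤ p + 1.
  module _ (p : ℕ) (prime : Prime p) (v : ℕ) (p≡2v+1 : p ≡ suc (v ℕ.+ v)) (p∤21 : ¬ (p ∣ 21)) where

    open LucasRing p
    open OddPrimeModulus prime v p≡2v+1
    open import Relation.Binary.Reasoning.Setoid setoid

    private
      c = (+ 21) ℤ.^ v

    -- Euler's criterion for 21: 21 (21^v)² = 21^p ≡ 21, so 21^v ≡ ±1.
    euler-21 : (c ≡[ p ] + 1) ⊎ (c ≡[ p ] -[1+ 0 ])
    euler-21 = square-root-of-one prime (+ 21) c p∤21
      (≡ₙ-trans (≡ₙ-reflexive (≡.sym 21ᵖ=21c²)) (≈₀ (trans (ι-^ (+ 21) p) (fermat-ι (+ 21)))))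
      where
        21ᵖ=21c² : (+ 21) ℤ.^ p ≡ + 21 * (c * c)
        21ᵖ=21c² = ≡.trans (≡.cong ((+ 21) ℤ.^_) p≡2v+1) (≡.cong (+ 21 *_) (ℤP.^-distribˡ-+-* (+ 21) v v))

    -- w² = 21, so w^p = 21^v w.
    wᵖ : w ^ p ≈ ι c ⊗ w
    wᵖ = trans wⁿ-euler (*-congʳ {w} (sym (ι-^ (+ 21) v)))

    data OrderBound : Set where
      residue : α ^ (v ℕ.+ v) ≈ 𝟙 → OrderBound
      non-residue : α ^ suc (suc (v ℕ.+ v)) ≈ 𝟙 → OrderBound

    order-bound : OrderBound
    order-bound = from-euler euler-21
      where
        from-euler : (c ≡[ p ] + 1) ⊎ (c ≡[ p ] -[1+ 0 ]) → OrderBound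
        from-euler (inj₁ c≡1) = residue (*-cancelˡ-unit β α (trans (*-comm β α) αβ=1) αᵖ=α)
          where
            wᵖ=w : w ^ p ≈ ι (+ 2) ⊗ α ⊕ ι (-[1+ 4 ])
            wᵖ=w = trans wᵖ (*-congʳ {w} (ι-cong c≡1))
            -- α^p = α, written as α α^(p-1) = α 1.
            αᵖ=α : α ⊗ α ^ (v ℕ.+ v) ≈ α ⊗ 𝟙
            αᵖ=α = begin
              α ⊗ α ^ (v ℕ.+ v)   ≈⟨ ^-congʳ α p≡2v+1 ⟨
              α ^ p               ≈⟨ αⁿ-from-wⁿ α wᵖ=w ⟩
              α                   ≈⟨ *-identityʳ α ⟨
              α ⊗ 𝟙               ∎
        from-euler (inj₂ c≡-1) = non-residue (begin
          α ⊗ α ^ suc (v ℕ.+ v) ≈⟨ *-congˡ {α} (^-congʳ α p≡2v+1) ⟨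
          α ⊗ α ^ p             ≈⟨ *-congˡ {α} (αⁿ-from-wⁿ β wᵖ=-w) ⟩
          α ⊗ β                 ≈⟨ αβ=1 ⟩
          𝟙                     ∎)
          where
            wᵖ=-w : w ^ p ≈ ι (+ 2) ⊗ β ⊕ ι (-[1+ 4 ])
            wᵖ=-w = trans wᵖ (*-congʳ {w} (ι-cong c≡-1))

    v≥1 : 1 ≤ v
    v≥1 = positive v p≡2v+1
      where
        positive : ∀ v → p ≡ suc (v ℕ.+ v) → 1 ≤ v
        positive zero p≡1 = ⊥-elim (ℕP.<-irrefl (≡.sym p≡1) (prime>1 prime))
        positive (suc _) _ = s≤s z≤n

    -1≉1 : ¬ (⊖ 𝟙 ≈ 𝟙)
    -1≉1 -1≈1 = ℕP.<⇒≱ p≥3 (∣⇒≤ (≡ₙ0⇒∣ {p} { -[1+ 1 ]} (≡ₙ-sub (≈₀ -1≈1))))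
      where
        p≥3 : 3 ≤ p
        p≥3 = ℕP.≤-trans (s≤s (ℕP.+-mono-≤ v≥1 v≥1)) (ℕP.≤-reflexive (≡.sym p≡2v+1))

    -- The bound: α^(2t) = -1 for t = k 2^j, so 2^(j+2) divides the exponent e ∈ {p - 1, p + 1}.
    2-adic-bound : ∀ N k j → p ∣ N → (+ N) ℤD.∣ S j (V (+ 5) (+ 1) k) → 2 ℕ.^ suc (suc j) ≤ suc p
    2-adic-bound N k j p∣N N∣S = bound order-bound
      where
        t = k ℕ.* 2 ℕ.^ j
        αᵗ+βᵗ=0 : α ^ t ⊕ β ^ t ≈ 𝟘
        αᵗ+βᵗ=0 = trans (sym (lucas-relation k j)) (ι-cong (≡ₙ-divisor p∣N (∣⇒≡ₙ0 N∣S)))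
        doubling : ∀ k x → k ℕ.* (2 ℕ.* x) ≡ k ℕ.* x ℕ.+ k ℕ.* x
        doubling = solve-∀
        α^2t=-1 : α ^ (k ℕ.* 2 ℕ.^ suc j) ≈ ⊖ 𝟙
        α^2t=-1 = trans (^-congʳ α (doubling k (2 ℕ.^ j))) (sum-zero⇒square-minus-one t αᵗ+βᵗ=0)
        through : ∀ e → 0 < e → e ≤ suc p → α ^ e ≈ 𝟙 → 2 ℕ.^ suc (suc j) ≤ suc p
        through e e>0 e≤p+1 αᵉ=1 =
          ℕP.≤-trans (∣⇒≤ ⦃ ℕ.>-nonZero e>0 ⦄ (two-adic-order α e k (suc j) -1≉1 αᵉ=1 α^2t=-1)) e≤p+1
        p+1≡2v+2 : suc p ≡ suc (suc (v ℕ.+ v))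
        p+1≡2v+2 = ≡.cong suc p≡2v+1
        bound : OrderBound → 2 ℕ.^ suc (suc j) ≤ suc p
        bound (residue αᵉ=1) =
          through (v ℕ.+ v) (ℕP.+-mono-≤ v≥1 z≤n)
                  (ℕP.≤-trans (ℕP.m≤n+m _ 2) (ℕP.≤-reflexive (≡.sym p+1≡2v+2))) αᵉ=1
        bound (non-residue αᵉ=1) = through (suc (suc (v ℕ.+ v))) (s≤s z≤n) (ℕP.≤-reflexive (≡.sym p+1≡2v+2)) αᵉ=1

module Residues where

  open import Data.Nat
  open import Data.Nat.Properties
  open import Data.Nat.DivMod
  open import Data.Nat.Divisibility using (divides)
  open import Data.Product using (_,_)
  open import Data.Sum using (_⊎_; inj₁; inj₂)
  open import Relation.Binary.PropositionalEquality
  open import Data.Nat.Tactic.RingSolver using (solve-∀)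
  open import Defs using (CongCond)

  quotient-form : ∀ n d .{{_ : NonZero d}} r → n % d ≡ r → n ≡ d * (n / d) + r
  quotient-form n d r n%d≡r = trans (m≡m%n+[m/n]*n n d) (trans (cong (_+ (n / d) * d) n%d≡r)
                                    (trans (+-comm r _) (cong (_+ r) (*-comm (n / d) d))))

  -- Since 2⁶ = 64 ≡ 1 (mod 21), 2^m mod 21 depends only on m mod 6.
  64^b≡1 : ∀ b → 64 ^ b % 21 ≡ 1
  64^b≡1 zero = refl
  64^b≡1 (suc b) = trans (%-distribˡ-* 64 (64 ^ b) 21) (cong (λ x → (64 % 21 * x) % 21) (64^b≡1 b))

  2^m-mod-21 : ∀ m → 2 ^ m % 21 ≡ 2 ^ (m % 6) % 21
  2^m-mod-21 m = begin
    2 ^ m % 21                                   ≡⟨ cong (λ e → 2 ^ e % 21) (m≡m%n+[m/n]*n m 6) ⟩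
    2 ^ (m % 6 + m / 6 * 6) % 21                 ≡⟨ cong (_% 21) (^-distribˡ-+-* 2 (m % 6) (m / 6 * 6)) ⟩
    (2 ^ (m % 6) * 2 ^ (m / 6 * 6)) % 21         ≡⟨ cong (λ e → (2 ^ (m % 6) * 2 ^ e) % 21) (*-comm (m / 6) 6) ⟩
    (2 ^ (m % 6) * 2 ^ (6 * (m / 6))) % 21       ≡⟨ cong (λ x → (2 ^ (m % 6) * x) % 21) (^-*-assoc 2 6 (m / 6)) ⟨
    (2 ^ (m % 6) * 64 ^ (m / 6)) % 21            ≡⟨ %-distribˡ-* (2 ^ (m % 6)) (64 ^ (m / 6)) 21 ⟩
    (2 ^ (m % 6) % 21 * (64 ^ (m / 6) % 21)) % 21 ≡⟨ cong (λ x → (2 ^ (m % 6) % 21 * x) % 21) (64^b≡1 (m / 6)) ⟩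
    (2 ^ (m % 6) % 21 * 1) % 21                  ≡⟨ cong (_% 21) (*-identityʳ (2 ^ (m % 6) % 21)) ⟩
    2 ^ (m % 6) % 21 % 21                        ≡⟨ m%n%n≡m%n (2 ^ (m % 6)) 21 ⟩
    2 ^ (m % 6) % 21                             ∎
    where open ≡-Reasoning

  N-mod-21 : ∀ k m → (k * 2 ^ m + 1) % 21 ≡ (k % 42 * 2 ^ (m % 6) + 1) % 21
  N-mod-21 k m = begin
    (k * 2 ^ m + 1) % 21                                  ≡⟨ %-distribˡ-+ (k * 2 ^ m) 1 21 ⟩
    ((k * 2 ^ m) % 21 + 1) % 21                           ≡⟨ cong (λ x → (x + 1) % 21) product ⟩
    ((k % 42 * 2 ^ (m % 6)) % 21 + 1) % 21                ≡⟨ %-distribˡ-+ (k % 42 * 2 ^ (m % 6)) 1 21 ⟨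
    (k % 42 * 2 ^ (m % 6) + 1) % 21                       ∎
    where
      open ≡-Reasoning
      product : (k * 2 ^ m) % 21 ≡ (k % 42 * 2 ^ (m % 6)) % 21
      product = begin
        (k * 2 ^ m) % 21                                  ≡⟨ %-distribˡ-* k (2 ^ m) 21 ⟩
        (k % 21 * (2 ^ m % 21)) % 21                      ≡⟨ cong₂ (λ x y → (x * y) % 21) (m∣n⇒o%n%m≡o%m 21 42 k (divides 2 refl)) (sym (2^m-mod-21 m)) ⟨
        (k % 42 % 21 * (2 ^ (m % 6) % 21)) % 21           ≡⟨ %-distribˡ-* (k % 42) (2 ^ (m % 6)) 21 ⟨
        (k % 42 * 2 ^ (m % 6)) % 21                       ∎

  -- The residue information about N = k 2^m + 1 and k that the proof uses: N ≡ 2 (mod 3),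
  -- N ≡ 3, 5 or 6 (mod 7) (so that -3 and -7 are non-residues modulo a prime N), and k odd.
  NonResidue7 : ℕ → Set
  NonResidue7 r = r ≡ 3 ⊎ r ≡ 5 ⊎ r ≡ 6

  record ResidueFacts (k m : ℕ) : Set where
    field
      s : ℕ
      N≡3s+2 : k * 2 ^ m + 1 ≡ 3 * s + 2
      q r : ℕ
      N≡7q+r : k * 2 ^ m + 1 ≡ 7 * q + r
      r-nonresidue : NonResidue7 r
      a : ℕ
      k≡2a+1 : k ≡ suc (a + a)

  from-classes : ∀ k m kr mr → k % 42 ≡ kr → m % 6 ≡ mr →
                 (kr * 2 ^ mr + 1) % 21 % 3 ≡ 2 → NonResidue7 ((kr * 2 ^ mr + 1) % 21 % 7) → kr % 2 ≡ 1 →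
                 ResidueFacts k m
  from-classes k m kr mr k%42≡kr m%6≡mr mod3 mod7 kr-odd = record
    { s = N / 3 ; N≡3s+2 = quotient-form N 3 2 (reduce 3 7 refl mod3)
    ; q = N / 7 ; r = N % 7 ; N≡7q+r = quotient-form N 7 (N % 7) refl
    ; r-nonresidue = subst NonResidue7 (sym (reduce 7 3 refl refl)) mod7
    ; a = k / 2 ; k≡2a+1 = trans (quotient-form k 2 1 k-odd) (twice+1 (k / 2)) }
    where
      N = k * 2 ^ m + 1
      N%21 : N % 21 ≡ (kr * 2 ^ mr + 1) % 21
      N%21 = trans (N-mod-21 k m) (cong₂ (λ x y → (x * 2 ^ y + 1) % 21) k%42≡kr m%6≡mr)
      reduce : ∀ d e .{{_ : NonZero d}} → d * e ≡ 21 → ∀ {x} → (kr * 2 ^ mr + 1) % 21 % d ≡ x → N % d ≡ x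
      reduce d e de≡21 eq = trans (sym (m∣n⇒o%n%m≡o%m d 21 N (divides e (sym (trans (*-comm e d) de≡21)))))
                                  (trans (cong (_% d) N%21) eq)
      k-odd : k % 2 ≡ 1
      k-odd = trans (sym (m∣n⇒o%n%m≡o%m 2 42 k (divides 21 refl))) (trans (cong (_% 2) k%42≡kr) kr-odd)
      twice+1 : ∀ a → 2 * a + 1 ≡ suc (a + a)
      twice+1 = solve-∀

  residues : ∀ k m → CongCond k m → ResidueFacts k m
  residues k m (inj₁ (ek , inj₁ em)) = from-classes k m 1 2 ek em refl (inj₂ (inj₁ refl)) refl
  residues k m (inj₁ (ek , inj₂ em)) = from-classes k m 1 4 ek em refl (inj₁ refl) refl
  residues k m (inj₂ (inj₁ (ek , em))) = from-classes k m 5 3 ek em refl (inj₂ (inj₂ refl)) refl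
  residues k m (inj₂ (inj₂ (inj₁ (ek , inj₁ em)))) = from-classes k m 11 3 ek em refl (inj₂ (inj₁ refl)) refl
  residues k m (inj₂ (inj₂ (inj₁ (ek , inj₂ em)))) = from-classes k m 11 5 ek em refl (inj₁ refl) refl
  residues k m (inj₂ (inj₂ (inj₂ (inj₁ (ek , em))))) = from-classes k m 13 4 ek em refl (inj₂ (inj₂ refl)) refl
  residues k m (inj₂ (inj₂ (inj₂ (inj₂ (inj₁ (ek , em)))))) = from-classes k m 17 5 ek em refl (inj₂ (inj₂ refl)) refl
  residues k m (inj₂ (inj₂ (inj₂ (inj₂ (inj₂ (inj₁ (ek , em))))))) = from-classes k m 19 0 ek em refl (inj₂ (inj₂ refl)) refl
  residues k m (inj₂ (inj₂ (inj₂ (inj₂ (inj₂ (inj₂ (inj₁ (ek , inj₁ em)))))))) = from-classes k m 23 1 ek em refl (inj₂ (inj₁ refl)) refl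
  residues k m (inj₂ (inj₂ (inj₂ (inj₂ (inj₂ (inj₂ (inj₁ (ek , inj₂ em)))))))) = from-classes k m 23 3 ek em refl (inj₁ refl) refl
  residues k m (inj₂ (inj₂ (inj₂ (inj₂ (inj₂ (inj₂ (inj₂ (inj₁ (ek , inj₁ em))))))))) = from-classes k m 25 0 ek em refl (inj₂ (inj₁ refl)) refl
  residues k m (inj₂ (inj₂ (inj₂ (inj₂ (inj₂ (inj₂ (inj₂ (inj₁ (ek , inj₂ em))))))))) = from-classes k m 25 2 ek em refl (inj₁ refl) refl
  residues k m (inj₂ (inj₂ (inj₂ (inj₂ (inj₂ (inj₂ (inj₂ (inj₂ (inj₁ (ek , inj₁ em)))))))))) = from-classes k m 29 1 ek em refl (inj₁ refl) refl
  residues k m (inj₂ (inj₂ (inj₂ (inj₂ (inj₂ (inj₂ (inj₂ (inj₂ (inj₁ (ek , inj₂ em)))))))))) = from-classes k m 29 5 ek em refl (inj₂ (inj₁ refl)) refl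
  residues k m (inj₂ (inj₂ (inj₂ (inj₂ (inj₂ (inj₂ (inj₂ (inj₂ (inj₂ (inj₁ (ek , em))))))))))) = from-classes k m 31 2 ek em refl (inj₂ (inj₂ refl)) refl
  residues k m (inj₂ (inj₂ (inj₂ (inj₂ (inj₂ (inj₂ (inj₂ (inj₂ (inj₂ (inj₂ (inj₁ (ek , inj₁ em)))))))))))) = from-classes k m 37 0 ek em refl (inj₁ refl) refl
  residues k m (inj₂ (inj₂ (inj₂ (inj₂ (inj₂ (inj₂ (inj₂ (inj₂ (inj₂ (inj₂ (inj₁ (ek , inj₂ em)))))))))))) = from-classes k m 37 4 ek em refl (inj₂ (inj₁ refl)) refl
  residues k m (inj₂ (inj₂ (inj₂ (inj₂ (inj₂ (inj₂ (inj₂ (inj₂ (inj₂ (inj₂ (inj₂ (ek , em)))))))))))) = from-classes k m 41 1 ek em refl (inj₂ (inj₂ refl)) refl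

open import Data.Nat using (ℕ; zero; suc; _+_; _*_; _^_; _<_; _≤_; _∸_; s≤s; z≤n)
import Data.Nat.Properties as ℕP
open import Data.Nat.Primality using (Prime; prime?; euclidsLemma; prime⇒irreducible)
open import Data.Nat.Divisibility as ℕD using (∣⇒≤; ∣m+n∣m⇒∣n; m∣m*n)
open import Data.Integer using (+_)
open import Data.Integer.Divisibility using (_∣_)
open import Data.Product using (_×_; _,_)
open import Data.Sum using (inj₁; inj₂)
open import Data.Empty using (⊥-elim)
open import Relation.Nullary using (¬_)
open import Relation.Nullary.Decidable using (from-yes)
open import Relation.Binary.PropositionalEquality
open import Data.Nat.Tactic.RingSolver using (solve-∀)
open import Defs
open Frobenius using (prime>1)
open Arithmetic
open Residues
open QuadraticCharacters
open Necessity
open Sufficiency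

prime∣prime : ∀ {p q} → Prime p → Prime q → p ℕD.∣ q → p ≡ q
prime∣prime p-prime q-prime p∣q with prime⇒irreducible q-prime p∣q
... | inj₁ p≡1 = ⊥-elim (ℕP.<-irrefl (sym p≡1) (prime>1 p-prime))
... | inj₂ p≡q = p≡q

prime-factor-odd : ∀ {p u} → Prime p → p ℕD.∣ suc (u + u) → ¬ (2 ℕD.∣ p)
prime-factor-odd {u = u} p-prime p∣N 2∣p =
  2∤odd u (subst (ℕD._∣ suc (u + u)) (sym (prime∣prime (from-yes (prime? 2)) p-prime 2∣p)) p∣N)

prime-factor-coprime-21 : ∀ {p N s q r} → Prime p → p ℕD.∣ N → N ≡ 3 * s + 2 → N ≡ 7 * q + r →
                          NonResidue7 r → ¬ (p ℕD.∣ 21)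
prime-factor-coprime-21 {p} {N} {s} {q} {r} p-prime p∣N N≡3s+2 N≡7q+r r-nonresidue p∣21
  with euclidsLemma 3 7 p-prime p∣21
... | inj₁ p∣3 with prime∣prime p-prime (from-yes (prime? 3)) p∣3
...   | refl = ℕP.<⇒≱ (ℕP.n<1+n 2) (∣⇒≤ (∣m+n∣m⇒∣n (subst (3 ℕD.∣_) N≡3s+2 p∣N) (m∣m*n s)))
prime-factor-coprime-21 {p} {N} {s} {q} {r} p-prime p∣N N≡3s+2 N≡7q+r r-nonresidue p∣21
    | inj₂ p∣7 with prime∣prime p-prime (from-yes (prime? 7)) p∣7
...   | refl = 7∤r r-nonresidue (∣m+n∣m⇒∣n (subst (7 ℕD.∣_) N≡7q+r p∣N) (m∣m*n q))
  where
    7∤r : ∀ {r} → NonResidue7 r → ¬ (7 ℕD.∣ r)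
    7∤r (inj₁ refl) 7∣3 = ℕP.<⇒≱ (s≤s (s≤s (s≤s (s≤s z≤n)))) (∣⇒≤ 7∣3)
    7∤r (inj₂ (inj₁ refl)) 7∣5 = ℕP.<⇒≱ (s≤s (s≤s (s≤s (s≤s (s≤s (s≤s z≤n)))))) (∣⇒≤ 7∣5)
    7∤r (inj₂ (inj₂ refl)) 7∣6 = ℕP.<⇒≱ ℕP.≤-refl (∣⇒≤ 7∣6)

N≡4t+1 : ∀ k j → k * 2 ^ suc (suc j) + 1 ≡ suc ((k * 2 ^ j + k * 2 ^ j) + (k * 2 ^ j + k * 2 ^ j))
N≡4t+1 k j = regroup k (2 ^ j)
  where
    regroup : ∀ k x → k * (2 * (2 * x)) + 1 ≡ suc ((k * x + k * x) + (k * x + k * x))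
    regroup = solve-∀

-- If N = k P + 1 (P = 2^(j+2), k < P) divides S_j(V_k(5,1)), every prime factor p of N
-- is at least P: the 2-adic order argument gives P ≤ p + 1, and p ≠ P - 1 as k is odd.
prime-factor-bound : ∀ k j → k < 2 ^ suc (suc j) → ResidueFacts k (suc (suc j)) →
                     (+ (k * 2 ^ suc (suc j) + 1)) ∣ S j (V (+ 5) (+ 1) k) →
                     ∀ p → Prime p → p ℕD.∣ k * 2 ^ suc (suc j) + 1 → 2 ^ suc (suc j) ≤ p
prime-factor-bound k j k<P facts N∣S p p-prime p∣N
  with odd-form p (prime-factor-odd {u = k * 2 ^ j + k * 2 ^ j} p-prime (subst (p ℕD.∣_) (N≡4t+1 k j) p∣N))
... | v , p≡2v+1 = ℕP.≤-pred (ℕP.≤∧≢⇒< P≤p+1 P≢p+1)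
  where
    open ResidueFacts facts
    X = 2 ^ suc j
    P = 2 ^ suc (suc j)
    P≡X+X : P ≡ X + X
    P≡X+X = cong (λ y → X + y) (ℕP.+-identityʳ X)
    P≤p+1 : P ≤ suc p
    P≤p+1 = 2-adic-bound p p-prime v p≡2v+1
              (prime-factor-coprime-21 {s = s} {q = q} {r = r} p-prime p∣N N≡3s+2 N≡7q+r r-nonresidue)
              _ k j p∣N N∣S
    P≢p+1 : P ≢ suc p
    P≢p+1 P≡p+1 = no-factor-one-below a X p (prime>1 p-prime)
      (subst₂ _<_ k≡2a+1 P≡X+X k<P) (trans (sym P≡X+X) P≡p+1)
      (subst₂ (λ k P → p ℕD.∣ k * P + 1) k≡2a+1 P≡X+X p∣N)

theorem3p3 : (m k : ℕ) → 2 < m → 0 < k → k < 2 ^ m → CongCond k m →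
    (Prime (k * 2 ^ m + 1) → (+ (k * 2 ^ m + 1)) ∣ S (m ∸ 2) (V (+ 5) (+ 1) k))
    × ((+ (k * 2 ^ m + 1)) ∣ S (m ∸ 2) (V (+ 5) (+ 1) k) → Prime (k * 2 ^ m + 1))
theorem3p3 zero k () 0<k k<P congruences
theorem3p3 (suc zero) k (s≤s ()) 0<k k<P congruences
theorem3p3 (suc (suc j)) k _ 0<k k<P congruences = necessity , sufficiency
  where
    facts = residues k (suc (suc j)) congruences
    open ResidueFacts facts
    P = 2 ^ suc (suc j)
    N = k * P + 1
    t = k * 2 ^ j

    necessity : Prime N → (+ N) ∣ S j (V (+ 5) (+ 1) k)
    necessity N-prime = N∣S N N-prime t (N≡4t+1 k j) s N≡3s+2
      (minus-3-nonresidue N N-prime (t + t) (N≡4t+1 k j) s N≡3s+2)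
      (minus-7-nonresidue N N-prime (t + t) (N≡4t+1 k j) q r N≡7q+r r-nonresidue) k j refl

    sufficiency : (+ N) ∣ S j (V (+ 5) (+ 1) k) → Prime N
    sufficiency N∣S = prime-if-prime-factors-large N P 1<N (proth-bound k P 1<P k<P)
                        (prime-factor-bound k j k<P facts N∣S)
      where
        1<P : 1 < P
        1<P = ℕP.*-monoʳ-≤ 2 (ℕP.m^n>0 2 (suc j))
        1<N : 1 < N
        1<N = ℕP.+-monoˡ-≤ 1 (ℕP.*-mono-≤ 0<k (ℕP.<⇒≤ 1<P))
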